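{- Let $p$ be a prime. For all integers $n\ge0$, $$\{pn\}=\begin{cases}\{p\}\cdot\{n\}_{s^2+2t,\,-t^2} & \text{if } p=2,\\ \{p\}\cdot\{n\}_{sP_{2p}(s,t),\,t^p} & \text{if } p\ge3.\end{cases}$$
   Context: Let $s,t$ be variables; the Lucas polynomials $\{n\}=\{n\}_{s,t}$ are $\{0\}=0$, $\{1\}=1$, $\{n\}=s\{n-1\}+t\{n-2\}$ for $n\ge2$, and $\{n\}_{a,b}$ denotes $\{n\}$ with $s,t$ replaced by $a,b$. Let $\Phi_n(q)$ be the $n$th cyclotomic polynomial and $\phi$ the Euler totient function; for $n\ge 2$ write uniquely $\Phi_n(q)=\sum_{0\le j\le\phi(n)/2}\gamma_j q^j(1+q)^{\phi(n)-2j}$ with $\gamma_j\in\mathbb{C}$ (possible since $\Phi_n$ is palindromic of degree $\phi(n)$ with constant term 1); the Lucas atom is $P_n(s,t)=\sum_j\gamma_j s^{\phi(n)-2j}(-t)^j$. -}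

module Defs where

open import Data.Nat as ℕ using (ℕ; zero; suc; _∸_; ⌊_/2⌋)
open import Data.Nat.GCD using (gcd)
open import Data.Nat.Divisibility using (_∣?_)
open import Data.Integer as ℤ using (ℤ; +_; -[1+_])
open import Data.List using (List; []; _∷_; length; filter; map; upTo; foldr)
open import Data.Vec using (Vec; toList)
open import Data.Bool using (if_then_else_)
open import Relation.Nullary using (does; yes; no)
open import Relation.Binary.PropositionalEquality using (_≡_)
open import Level using (Level)
open import Algebra.Bundles using (CommutativeRing)

-- Integer polynomials in one variable q, as coefficient lists
-- (constant term first).  Equality of polynomials = equality after
-- stripping trailing zero coefficients.

Poly : Set
Poly = List ℤ

addP : Poly → Poly → Poly
addP []       g        = g
addP (a ∷ f)  []       = a ∷ f
addP (a ∷ f)  (b ∷ g)  = (a ℤ.+ b) ∷ addP f g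

scaleP : ℤ → Poly → Poly
scaleP c = map (c ℤ.*_)

negP : Poly → Poly
negP = scaleP (ℤ.- (+ 1))

subP : Poly → Poly → Poly
subP f g = addP f (negP g)

mulP : Poly → Poly → Poly
mulP []      g = []
mulP (a ∷ f) g = addP (scaleP a g) (+ 0 ∷ mulP f g)

norm : Poly → Poly
norm [] = []
norm (a ∷ f) with norm f
... | [] = if does (a ℤ.≟ + 0) then [] else (a ∷ [])
... | r  = a ∷ r

_≈P_ : Poly → Poly → Set
f ≈P g = norm f ≡ norm g

powP : Poly → ℕ → Poly
powP f zero    = + 1 ∷ []
powP f (suc k) = mulP f (powP f k)

qP : Poly
qP = + 0 ∷ + 1 ∷ []

lastZ : Poly → ℤ
lastZ []          = + 0
lastZ (a ∷ [])    = a
lastZ (a ∷ b ∷ f) = lastZ (b ∷ f)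

divMonicF : ℕ → Poly → Poly → Poly
divMonicF zero       f g = []
divMonicF (suc fuel) f g with norm f | norm g
... | f' | g' with length f' ℕ.<? length g'
...   | yes _ = []
...   | no  _ =
        let term = mulP (lastZ f' ∷ []) (powP qP (length f' ∸ length g'))
        in addP term (divMonicF fuel (subP f' (mulP term g')) g)

divMonic : Poly → Poly → Poly
divMonic f g = divMonicF (suc (length f)) f g

-- Cyclotomic polynomials:  Φ_n = (q^n - 1) / ∏_{d ∣ n, d < n} Φ_d,
-- computed by recursion on d < n (with fuel n).

properDivisors : ℕ → List ℕ
properDivisors n = filter (λ d → d ∣? n) (map suc (upTo (n ∸ 1)))

cycF : ℕ → ℕ → Poly
cycF zero       n = + 1 ∷ []
cycF (suc fuel) n =
  divMonic (subP (powP qP n) (+ 1 ∷ []))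
           (foldr (λ d acc → mulP (cycF fuel d) acc) (+ 1 ∷ []) (properDivisors n))

Φ : ℕ → Poly
Φ n = cycF n n

totient : ℕ → ℕ
totient n = length (filter (λ k → gcd k n ℕ.≟ 1) (map suc (upTo n)))

expandF : ℕ → ℕ → List ℤ → Poly
expandF m j []      = []
expandF m j (g ∷ gs) =
  addP (scaleP g (mulP (powP qP j) (powP (+ 1 ∷ + 1 ∷ []) (m ∸ (2 ℕ.* j)))))
       (expandF m (suc j) gs)

-- Φ_n(q) = Σ_{0 ≤ j ≤ φ(n)/2} γ_j q^j (1+q)^{φ(n)-2j}
IsAtomCoeffs : (n : ℕ) → Vec ℤ (suc ⌊ totient n /2⌋) → Set
IsAtomCoeffs n γ = Φ n ≈P expandF (totient n) 0 (toList γ)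

module _ {c ℓ : Level} (R : CommutativeRing c ℓ) where
  open CommutativeRing R

  pow : Carrier → ℕ → Carrier
  pow x zero    = 1#
  pow x (suc k) = x * pow x k

  nat→R : ℕ → Carrier
  nat→R zero    = 0#
  nat→R (suc k) = 1# + nat→R k

  ℤ→R : ℤ → Carrier
  ℤ→R (+ k)      = nat→R k
  ℤ→R -[1+ k ]   = - nat→R (suc k)

  lucas : Carrier → Carrier → ℕ → Carrier
  lucas s t zero          = 0#
  lucas s t (suc zero)    = 1#
  lucas s t (suc (suc n)) = s * lucas s t (suc n) + t * lucas s t n

  atomF : Carrier → Carrier → ℕ → ℕ → List ℤ → Carrier
  atomF s t m j []       = 0#
  atomF s t m j (g ∷ gs) =
    ℤ→R g * pow s (m ∸ (2 ℕ.* j)) * pow (- t) j + atomF s t m (suc j) gs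

  lucasAtom : (n : ℕ) → Vec ℤ (suc ⌊ totient n /2⌋) → Carrier → Carrier → Carrier
  lucasAtom n γ s t = atomF s t (totient n) 0 (toList γ)

module Submission where

-- For K = k + 1, the sequence j ↦ {j + 2K} − V {j + K} − T {j}, with V = {K + 1} + t {K − 1}
-- and T = −(−t)ᴷ, satisfies the Lucas recurrence and vanishes at j = 0, 1 (addition formula
-- and Cassini's identity), so {K n} = {K} · {n}_{V,T}.  For p = 2 this is the claim.  For odd p,
-- T = tᵖ, and it remains to see that V = {p + 1} + t {p − 1} equals s · P₂ₚ(s, t).
-- Division by Φ₁Φ₂Φₚ shows Φ₂ₚ(q) = Σ_{i<p} (−q)ⁱ; comparing degrees in the defining expansion
-- then also gives φ(2p) = p − 1.  Let α, β be the roots of X² − sX − t in R[α]/(α² − sα − t).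
-- Evaluating the expansion homogeneously at q = α/β turns qʲ(1 + q)^{p−1−2j} into (−t)ʲ s^{p−1−2j},
-- so s · P₂ₚ(s, t) = (α + β) Σ_{i<p} (−α)ⁱ β^{p−1−i} = αᵖ + βᵖ, which is {p + 1} + t {p − 1}.

open import Defs
open import Level using (Level)
open import Algebra.Bundles using (CommutativeRing; AbelianGroup)
import Algebra.Construct.DirectProduct as DirectProduct
open import Algebra.Solver.Ring.AlmostCommutativeRing
  using (AlmostCommutativeRing; fromCommutativeRing; _-Raw-AlmostCommutative⟶_; -raw-almostCommutative⟶)
import Algebra.Solver.Ring
open import Data.Nat as ℕ using (ℕ; zero; suc; pred; _∸_; _≤_; _<_; _≥_; z≤n; s≤s; NonZero; ⌊_/2⌋; ⌈_/2⌉)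
import Data.Nat.Properties as ℕ
open import Data.Nat.Tactic.RingSolver using () renaming (solve-∀ to ℕ-solve-∀)
open import Data.Nat.Divisibility using (_∣_; divides; _∣?_; ∣⇒≤; 1∣_)
open import Data.Nat.Primality using (Prime; euclidsLemma; prime⇒irreducible; prime⇒nonZero)
open import Data.Integer as ℤ using (ℤ; +_; -[1+_]; _⊖_)
import Data.Integer.Properties as ℤ
open import Data.Integer.Tactic.RingSolver using (solve-∀)
open import Data.List using (List; []; _∷_; _++_; length; map; filter; foldr; upTo; applyUpTo)
import Data.List.Properties as List
open import Data.List.Relation.Unary.All using (All; []; _∷_)
open import Data.Maybe using (Maybe; nothing; just)
open import Data.Product using (Σ; _×_; _,_; proj₁; proj₂)
open import Data.Sum using (_⊎_; inj₁; inj₂)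
open import Data.Empty using (⊥-elim)
open import Data.Vec using (Vec; toList)
import Data.Vec.Properties as Vec
open import Relation.Nullary using (¬_; yes; no)
open import Relation.Binary.PropositionalEquality as P using (_≡_)

ℤ-as-⊖ : ∀ i → Σ ℕ λ m → Σ ℕ λ n → i P.≡ m ⊖ n
ℤ-as-⊖ (+ zero)    = 0 , 0 , P.refl
ℤ-as-⊖ (+ suc n)   = suc n , 0 , P.refl
ℤ-as-⊖ -[1+ n ]    = 0 , suc n , P.refl

⊖-as-difference : ∀ m n → m ⊖ n P.≡ + m ℤ.- + n
⊖-as-difference m n = P.sym (ℤ.m-n≡m⊖n m n)

⊖-+-⊖ : ∀ m n o p → (m ⊖ n) ℤ.+ (o ⊖ p) P.≡ (m ℕ.+ o) ⊖ (n ℕ.+ p)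
⊖-+-⊖ m n o p = begin
  (m ⊖ n) ℤ.+ (o ⊖ p)              ≡⟨ P.cong₂ ℤ._+_ (⊖-as-difference m n) (⊖-as-difference o p) ⟩
  (+ m ℤ.- + n) ℤ.+ (+ o ℤ.- + p)  ≡⟨ interchange (+ m) (+ n) (+ o) (+ p) ⟩
  (+ m ℤ.+ + o) ℤ.- (+ n ℤ.+ + p)  ≡⟨ P.cong₂ ℤ._-_ (ℤ.pos-+ m o) (ℤ.pos-+ n p) ⟨
  + (m ℕ.+ o) ℤ.- + (n ℕ.+ p)      ≡⟨ ⊖-as-difference (m ℕ.+ o) (n ℕ.+ p) ⟨
  (m ℕ.+ o) ⊖ (n ℕ.+ p)            ∎
  where
  open P.≡-Reasoning
  interchange : ∀ a b c d → (a ℤ.- b) ℤ.+ (c ℤ.- d) P.≡ (a ℤ.+ c) ℤ.- (b ℤ.+ d)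
  interchange = solve-∀

⊖-*-⊖ : ∀ m n o p → (m ⊖ n) ℤ.* (o ⊖ p) P.≡ (m ℕ.* o ℕ.+ n ℕ.* p) ⊖ (m ℕ.* p ℕ.+ n ℕ.* o)
⊖-*-⊖ m n o p = begin
  (m ⊖ n) ℤ.* (o ⊖ p)                                              ≡⟨ P.cong₂ ℤ._*_ (⊖-as-difference m n) (⊖-as-difference o p) ⟩
  (+ m ℤ.- + n) ℤ.* (+ o ℤ.- + p)                                  ≡⟨ expand (+ m) (+ n) (+ o) (+ p) ⟩
  (+ m ℤ.* + o ℤ.+ + n ℤ.* + p) ℤ.- (+ m ℤ.* + p ℤ.+ + n ℤ.* + o)  ≡⟨ P.cong₂ ℤ._-_ (pos-sum-of-products m o n p) (pos-sum-of-products m p n o) ⟨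
  + (m ℕ.* o ℕ.+ n ℕ.* p) ℤ.- + (m ℕ.* p ℕ.+ n ℕ.* o)              ≡⟨ ⊖-as-difference (m ℕ.* o ℕ.+ n ℕ.* p) (m ℕ.* p ℕ.+ n ℕ.* o) ⟨
  (m ℕ.* o ℕ.+ n ℕ.* p) ⊖ (m ℕ.* p ℕ.+ n ℕ.* o)                    ∎
  where
  open P.≡-Reasoning
  expand : ∀ a b c d → (a ℤ.- b) ℤ.* (c ℤ.- d) P.≡ (a ℤ.* c ℤ.+ b ℤ.* d) ℤ.- (a ℤ.* d ℤ.+ b ℤ.* c)
  expand = solve-∀
  pos-sum-of-products : ∀ a b c d → + (a ℕ.* b ℕ.+ c ℕ.* d) P.≡ + a ℤ.* + b ℤ.+ + c ℤ.* + d
  pos-sum-of-products a b c d = P.trans (ℤ.pos-+ (a ℕ.* b) (c ℕ.* d)) (P.cong₂ ℤ._+_ (ℤ.pos-* a b) (ℤ.pos-* c d))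

module IntegerCast {c ℓ : Level} (R : CommutativeRing c ℓ) where
  open CommutativeRing R
  open import Relation.Binary.Reasoning.Setoid setoid
  open import Algebra.Properties.Ring ring using (-0#≈0#; x[y-z]≈xy-xz; [y-z]x≈yx-zx; ⁻¹-anti-homo‿-)
  open import Algebra.Properties.Semiring.Mult semiring using (×-homo-+; ×1-homo-*)
  open import Algebra.Definitions.RawMonoid +-rawMonoid using () renaming (_×_ to _·_)

  almostCommutativeRing : AlmostCommutativeRing c ℓ
  almostCommutativeRing = fromCommutativeRing R

  module ConstantFree = Algebra.Solver.Ring (AlmostCommutativeRing.rawRing almostCommutativeRing)
    almostCommutativeRing (-raw-almostCommutative⟶ almostCommutativeRing) (λ _ _ → nothing)

  [a+c]-[b+d]≈[a-b]+[c-d] : ∀ a b c d → (a + c) - (b + d) ≈ (a - b) + (c - d)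
  [a+c]-[b+d]≈[a-b]+[c-d] = solve 4 (λ a b c d → (a :+ c) :- (b :+ d) := (a :- b) :+ (c :- d)) refl
    where open ConstantFree

  [a-b][c-d]≈[ac+bd]-[ad+bc] : ∀ a b c d → (a - b) * (c - d) ≈ (a * c + b * d) - (a * d + b * c)
  [a-b][c-d]≈[ac+bd]-[ad+bc] a b c d = begin
    (a - b) * (c - d)                  ≈⟨ [y-z]x≈yx-zx (c - d) a b ⟩
    a * (c - d) - b * (c - d)          ≈⟨ +-cong (x[y-z]≈xy-xz a c d) (-‿cong (x[y-z]≈xy-xz b c d)) ⟩
    (a * c - a * d) - (b * c - b * d)  ≈⟨ +-congˡ (⁻¹-anti-homo‿- (b * c) (b * d)) ⟩
    (a * c - a * d) + (b * d - b * c)  ≈⟨ [a+c]-[b+d]≈[a-b]+[c-d] (a * c) (a * d) (b * d) (b * c) ⟨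
    (a * c + b * d) - (a * d + b * c)  ∎

  nat→R≈·1# : ∀ k → nat→R R k ≈ k · 1#
  nat→R≈·1# zero    = refl
  nat→R≈·1# (suc k) = +-congˡ (nat→R≈·1# k)

  nat→R-+ : ∀ m n → nat→R R (m ℕ.+ n) ≈ nat→R R m + nat→R R n
  nat→R-+ m n = begin
    nat→R R (m ℕ.+ n)      ≈⟨ nat→R≈·1# (m ℕ.+ n) ⟩
    (m ℕ.+ n) · 1#         ≈⟨ ×-homo-+ 1# m n ⟩
    m · 1# + n · 1#        ≈⟨ +-cong (nat→R≈·1# m) (nat→R≈·1# n) ⟨
    nat→R R m + nat→R R n  ∎

  nat→R-* : ∀ m n → nat→R R (m ℕ.* n) ≈ nat→R R m * nat→R R n
  nat→R-* m n = begin
    nat→R R (m ℕ.* n)      ≈⟨ nat→R≈·1# (m ℕ.* n) ⟩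
    (m ℕ.* n) · 1#         ≈⟨ ×1-homo-* m n ⟩
    m · 1# * n · 1#        ≈⟨ *-cong (nat→R≈·1# m) (nat→R≈·1# n) ⟨
    nat→R R m * nat→R R n  ∎

  ℤ→R-⊖ : ∀ m n → ℤ→R R (m ⊖ n) ≈ nat→R R m - nat→R R n
  ℤ→R-⊖ zero    zero    = sym (-‿inverseʳ 0#)
  ℤ→R-⊖ (suc m) zero    = sym (trans (+-congˡ -0#≈0#) (+-identityʳ _))
  ℤ→R-⊖ zero    (suc n) = sym (+-identityˡ _)
  ℤ→R-⊖ (suc m) (suc n) = begin
    ℤ→R R (suc m ⊖ suc n)                ≡⟨ P.cong (ℤ→R R) (ℤ.[1+m]⊖[1+n]≡m⊖n m n) ⟩
    ℤ→R R (m ⊖ n)                        ≈⟨ ℤ→R-⊖ m n ⟩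
    nat→R R m - nat→R R n                ≈⟨ +-identityˡ _ ⟨
    0# + (nat→R R m - nat→R R n)         ≈⟨ +-congʳ (-‿inverseʳ 1#) ⟨
    (1# - 1#) + (nat→R R m - nat→R R n)  ≈⟨ [a+c]-[b+d]≈[a-b]+[c-d] 1# 1# _ _ ⟨
    nat→R R (suc m) - nat→R R (suc n)    ∎

  ℤ→R-+ : ∀ i j → ℤ→R R (i ℤ.+ j) ≈ ℤ→R R i + ℤ→R R j
  ℤ→R-+ i j with ℤ-as-⊖ i | ℤ-as-⊖ j
  ... | m , n , P.refl | o , p , P.refl = begin
    ℤ→R R ((m ⊖ n) ℤ.+ (o ⊖ p))            ≡⟨ P.cong (ℤ→R R) (⊖-+-⊖ m n o p) ⟩
    ℤ→R R ((m ℕ.+ o) ⊖ (n ℕ.+ p))          ≈⟨ ℤ→R-⊖ (m ℕ.+ o) (n ℕ.+ p) ⟩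
    nat→R R (m ℕ.+ o) - nat→R R (n ℕ.+ p)  ≈⟨ +-cong (nat→R-+ m o) (-‿cong (nat→R-+ n p)) ⟩
    (M + O) - (N + Q)                      ≈⟨ [a+c]-[b+d]≈[a-b]+[c-d] M N O Q ⟩
    (M - N) + (O - Q)                      ≈⟨ +-cong (ℤ→R-⊖ m n) (ℤ→R-⊖ o p) ⟨
    ℤ→R R (m ⊖ n) + ℤ→R R (o ⊖ p)          ∎
    where M = nat→R R m ; N = nat→R R n ; O = nat→R R o ; Q = nat→R R p

  ℤ→R-* : ∀ i j → ℤ→R R (i ℤ.* j) ≈ ℤ→R R i * ℤ→R R j
  ℤ→R-* i j with ℤ-as-⊖ i | ℤ-as-⊖ j
  ... | m , n , P.refl | o , p , P.refl = begin
    ℤ→R R ((m ⊖ n) ℤ.* (o ⊖ p))                                    ≡⟨ P.cong (ℤ→R R) (⊖-*-⊖ m n o p) ⟩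
    ℤ→R R ((m ℕ.* o ℕ.+ n ℕ.* p) ⊖ (m ℕ.* p ℕ.+ n ℕ.* o))          ≈⟨ ℤ→R-⊖ (m ℕ.* o ℕ.+ n ℕ.* p) (m ℕ.* p ℕ.+ n ℕ.* o) ⟩
    nat→R R (m ℕ.* o ℕ.+ n ℕ.* p) - nat→R R (m ℕ.* p ℕ.+ n ℕ.* o)  ≈⟨ +-cong (sum-of-products m o n p) (-‿cong (sum-of-products m p n o)) ⟩
    (M * O + N * Q) - (M * Q + N * O)                              ≈⟨ [a-b][c-d]≈[ac+bd]-[ad+bc] M N O Q ⟨
    (M - N) * (O - Q)                                              ≈⟨ *-cong (ℤ→R-⊖ m n) (ℤ→R-⊖ o p) ⟨
    ℤ→R R (m ⊖ n) * ℤ→R R (o ⊖ p)                                  ∎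
    where
    M = nat→R R m ; N = nat→R R n ; O = nat→R R o ; Q = nat→R R p
    sum-of-products : ∀ a b c d → nat→R R (a ℕ.* b ℕ.+ c ℕ.* d) ≈ nat→R R a * nat→R R b + nat→R R c * nat→R R d
    sum-of-products a b c d = trans (nat→R-+ (a ℕ.* b) (c ℕ.* d)) (+-cong (nat→R-* a b) (nat→R-* c d))

  ℤ→R-neg : ∀ i → ℤ→R R (ℤ.- i) ≈ - ℤ→R R i
  ℤ→R-neg i with ℤ-as-⊖ i
  ... | m , n , P.refl = begin
    ℤ→R R (ℤ.- (m ⊖ n))        ≡⟨ P.cong (ℤ→R R) (ℤ.⊖-swap n m) ⟨
    ℤ→R R (n ⊖ m)              ≈⟨ ℤ→R-⊖ n m ⟩
    nat→R R n - nat→R R m      ≈⟨ ⁻¹-anti-homo‿- (nat→R R m) (nat→R R n) ⟨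
    - (nat→R R m - nat→R R n)  ≈⟨ -‿cong (ℤ→R-⊖ m n) ⟨
    - ℤ→R R (m ⊖ n)            ∎

  -- Agrees with ℤ→R R, but 0 and 1 reduce to 0# and 1#, so that solver
  -- constants match those literals definitionally.
  coefficient : ℤ → Carrier
  coefficient (+ 0) = 0#
  coefficient (+ 1) = 1#
  coefficient i     = ℤ→R R i

  coefficient≈ℤ→R : ∀ i → coefficient i ≈ ℤ→R R i
  coefficient≈ℤ→R (+ 0)           = refl
  coefficient≈ℤ→R (+ 1)           = sym (+-identityʳ 1#)
  coefficient≈ℤ→R (+ suc (suc n)) = refl
  coefficient≈ℤ→R -[1+ n ]        = refl

  coefficient-homomorphism : ℤ.+-*-rawRing -Raw-AlmostCommutative⟶ almostCommutativeRing
  coefficient-homomorphism = record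
    { ⟦_⟧    = coefficient
    ; +-homo = λ i j → transport (ℤ→R-+ i j) (coefficient≈ℤ→R (i ℤ.+ j)) (+-cong (coefficient≈ℤ→R i) (coefficient≈ℤ→R j))
    ; *-homo = λ i j → transport (ℤ→R-* i j) (coefficient≈ℤ→R (i ℤ.* j)) (*-cong (coefficient≈ℤ→R i) (coefficient≈ℤ→R j))
    ; -‿homo = λ i → transport (ℤ→R-neg i) (coefficient≈ℤ→R (ℤ.- i)) (-‿cong (coefficient≈ℤ→R i))
    ; 0-homo = refl
    ; 1-homo = refl
    }
    where
    transport : ∀ {x y x′ y′} → x ≈ y → x′ ≈ x → y′ ≈ y → x′ ≈ y′
    transport x≈y x′≈x y′≈y = trans x′≈x (trans x≈y (sym y′≈y))

  coefficient-≟ : ∀ i j → Maybe (coefficient i ≈ coefficient j)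
  coefficient-≟ i j with i ℤ.≟ j
  ... | yes P.refl = just refl
  ... | no _       = nothing

  module Solver = Algebra.Solver.Ring ℤ.+-*-rawRing almostCommutativeRing coefficient-homomorphism coefficient-≟

module LucasSequence {c ℓ : Level} (R : CommutativeRing c ℓ) (s t : CommutativeRing.Carrier R) where
  open CommutativeRing R
  open import Relation.Binary.Reasoning.Setoid setoid
  open IntegerCast R using (module Solver)
  open Solver

  u : ℕ → Carrier
  u = lucas R s t

  SatisfiesRecurrence : (ℕ → Carrier) → Set ℓ
  SatisfiesRecurrence f = ∀ n → f (suc (suc n)) ≈ s * f (suc n) + t * f n

  recurrence-solution : ∀ f → SatisfiesRecurrence f → ∀ j → f (suc j) ≈ f 1 * u (suc j) + t * f 0 * u j
  recurrence-solution f rec zero = solve 3 (λ f₁ f₀ t → f₁ := f₁ :* con (+ 1) :+ t :* f₀ :* con (+ 0)) refl (f 1) (f 0) t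
  recurrence-solution f rec (suc zero) = trans (rec 0)
    (solve 4 (λ f₁ f₀ s t → s :* f₁ :+ t :* f₀ := f₁ :* (s :* con (+ 1) :+ t :* con (+ 0)) :+ t :* f₀ :* con (+ 1)) refl (f 1) (f 0) s t)
  recurrence-solution f rec (suc (suc j)) = begin
    f (3 ℕ.+ j)                                ≈⟨ rec (suc j) ⟩
    s * f (2 ℕ.+ j) + t * f (suc j)            ≈⟨ +-cong (*-congˡ (recurrence-solution f rec (suc j))) (*-congˡ (recurrence-solution f rec j)) ⟩
    s * (f 1 * u (2 ℕ.+ j) + t * f 0 * u (suc j)) + t * (f 1 * u (suc j) + t * f 0 * u j)
      ≈⟨ solve 6 (λ f₁ f₀ s t u₀ u₁ → s :* (f₁ :* (s :* u₁ :+ t :* u₀) :+ t :* f₀ :* u₁) :+ t :* (f₁ :* u₁ :+ t :* f₀ :* u₀)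
         := f₁ :* (s :* (s :* u₁ :+ t :* u₀) :+ t :* u₁) :+ t :* f₀ :* (s :* u₁ :+ t :* u₀)) refl (f 1) (f 0) s t (u j) (u (suc j)) ⟩
    f 1 * u (3 ℕ.+ j) + t * f 0 * u (2 ℕ.+ j)  ∎

  recurrence-zero : ∀ f → SatisfiesRecurrence f → f 0 ≈ 0# → f 1 ≈ 0# → ∀ j → f j ≈ 0#
  recurrence-zero f rec f₀≈0 f₁≈0 zero    = f₀≈0
  recurrence-zero f rec f₀≈0 f₁≈0 (suc j) = begin
    f (suc j)                        ≈⟨ recurrence-solution f rec j ⟩
    f 1 * u (suc j) + t * f 0 * u j  ≈⟨ +-cong (*-congʳ f₁≈0) (*-congʳ (*-congˡ f₀≈0)) ⟩
    0# * u (suc j) + t * 0# * u j    ≈⟨ solve 3 (λ t u₀ u₁ → con (+ 0) :* u₁ :+ t :* con (+ 0) :* u₀ := con (+ 0)) refl t (u j) (u (suc j)) ⟩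
    0#                               ∎

  lucas-+ : ∀ m j → u (suc j ℕ.+ m) ≈ u (suc m) * u (suc j) + t * u m * u j
  lucas-+ m = recurrence-solution (λ j → u (j ℕ.+ m)) (λ _ → refl)

  lucas-cassini : ∀ m → u (suc m) * u (suc m) - u m * u (2 ℕ.+ m) ≈ pow R (- t) m
  lucas-cassini zero = solve 2 (λ s t → con (+ 1) :* con (+ 1) :- con (+ 0) :* (s :* con (+ 1) :+ t :* con (+ 0)) := con (+ 1)) refl s t
  lucas-cassini (suc m) = begin
    u (2 ℕ.+ m) * u (2 ℕ.+ m) - u (suc m) * u (3 ℕ.+ m)
      ≈⟨ solve 4 (λ s t u₀ u₁ → (s :* u₁ :+ t :* u₀) :* (s :* u₁ :+ t :* u₀) :- u₁ :* (s :* (s :* u₁ :+ t :* u₀) :+ t :* u₁)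
         := (:- t) :* (u₁ :* u₁ :- u₀ :* (s :* u₁ :+ t :* u₀))) refl s t (u m) (u (suc m)) ⟩
    (- t) * (u (suc m) * u (suc m) - u m * u (2 ℕ.+ m))  ≈⟨ *-congˡ (lucas-cassini m) ⟩
    (- t) * pow R (- t) m                                ∎

  module _ (k : ℕ) {V T : Carrier} (V≈ : V ≈ u (2 ℕ.+ k) + t * u k) (T≈ : T ≈ t * pow R (- t) k) where
    private
      K = suc k

    lucas-step-recurrence : ∀ j → u (j ℕ.+ (K ℕ.+ K)) ≈ V * u (j ℕ.+ K) + T * u j
    lucas-step-recurrence j = begin
      u (j ℕ.+ (K ℕ.+ K))
        ≈⟨ solve 3 (λ x y z → x := (x :- y :- z) :+ (y :+ z)) refl (u (j ℕ.+ (K ℕ.+ K))) (V * u (j ℕ.+ K)) (T * u j) ⟩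
      f j + (V * u (j ℕ.+ K) + T * u j)  ≈⟨ +-congʳ (recurrence-zero f f-rec f₀≈0 f₁≈0 j) ⟩
      0# + (V * u (j ℕ.+ K) + T * u j)   ≈⟨ +-identityˡ _ ⟩
      V * u (j ℕ.+ K) + T * u j          ∎
      where
      f : ℕ → Carrier
      f j = u (j ℕ.+ (K ℕ.+ K)) - V * u (j ℕ.+ K) - T * u j

      f-rec : SatisfiesRecurrence f
      f-rec n = solve 10 (λ s t V T x₀ x₁ y₀ y₁ z₀ z₁ →
          (s :* x₁ :+ t :* x₀) :- V :* (s :* y₁ :+ t :* y₀) :- T :* (s :* z₁ :+ t :* z₀)
          := s :* (x₁ :- V :* y₁ :- T :* z₁) :+ t :* (x₀ :- V :* y₀ :- T :* z₀)) refl
          s t V T (u (n ℕ.+ (K ℕ.+ K))) (u (suc n ℕ.+ (K ℕ.+ K))) (u (n ℕ.+ K)) (u (suc n ℕ.+ K)) (u n) (u (suc n))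

      f₀≈0 : f 0 ≈ 0#
      f₀≈0 = begin
        u (K ℕ.+ K) - V * u K - T * 0#                                          ≈⟨ +-congʳ (+-cong (lucas-+ K k) (-‿cong (*-congʳ V≈))) ⟩
        u (suc K) * u K + t * u K * u k - (u (suc K) + t * u k) * u K - T * 0#
          ≈⟨ solve 5 (λ u₂ u₁ u₀ t T → u₂ :* u₁ :+ t :* u₁ :* u₀ :- (u₂ :+ t :* u₀) :* u₁ :- T :* con (+ 0) := con (+ 0))
             refl (u (suc K)) (u K) (u k) t T ⟩
        0#                                                                      ∎

      f₁≈0 : f 1 ≈ 0#
      f₁≈0 = begin
        u (suc (K ℕ.+ K)) - V * u (suc K) - T * 1#
          ≈⟨ +-cong (+-cong (lucas-+ K K) (-‿cong (*-congʳ V≈))) (-‿cong (*-congʳ (trans T≈ (*-congˡ (sym (lucas-cassini k)))))) ⟩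
        u (suc K) * u (suc K) + t * u K * u K - (u (suc K) + t * u k) * u (suc K) - t * (u K * u K - u k * u (suc K)) * 1#
          ≈⟨ solve 4 (λ u₂ u₁ u₀ t → u₂ :* u₂ :+ t :* u₁ :* u₁ :- (u₂ :+ t :* u₀) :* u₂ :- t :* (u₁ :* u₁ :- u₀ :* u₂) :* con (+ 1) := con (+ 0))
             refl (u (suc K)) (u K) (u k) t ⟩
        0#  ∎

    lucas-multiple : ∀ n → u (K ℕ.* n) ≈ u K * lucas R V T n
    lucas-multiple zero = trans (reflexive (P.cong u (ℕ.*-zeroʳ K))) (sym (zeroʳ _))
    lucas-multiple (suc zero) = trans (reflexive (P.cong u (ℕ.*-identityʳ K))) (sym (*-identityʳ _))
    lucas-multiple (suc (suc n)) = begin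
      u (K ℕ.* (2 ℕ.+ n))                      ≡⟨ P.cong u (index₂ K n) ⟩
      u (K ℕ.* n ℕ.+ (K ℕ.+ K))                ≈⟨ lucas-step-recurrence (K ℕ.* n) ⟩
      V * u (K ℕ.* n ℕ.+ K) + T * u (K ℕ.* n)  ≡⟨ P.cong (λ i → V * u i + T * u (K ℕ.* n)) (index₁ K n) ⟨
      V * u (K ℕ.* suc n) + T * u (K ℕ.* n)    ≈⟨ +-cong (*-congˡ (lucas-multiple (suc n))) (*-congˡ (lucas-multiple n)) ⟩
      V * (u K * l (suc n)) + T * (u K * l n)
        ≈⟨ solve 5 (λ V T x y z → V :* (x :* y) :+ T :* (x :* z) := x :* (V :* y :+ T :* z)) refl V T (u K) (l (suc n)) (l n) ⟩
      u K * l (2 ℕ.+ n)                        ∎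
      where
      l = lucas R V T
      index₂ : ∀ K n → K ℕ.* (2 ℕ.+ n) P.≡ K ℕ.* n ℕ.+ (K ℕ.+ K)
      index₂ = ℕ-solve-∀
      index₁ : ∀ K n → K ℕ.* suc n P.≡ K ℕ.* n ℕ.+ K
      index₁ = ℕ-solve-∀

module PolynomialCoefficients where
  open import Data.Integer using (_+_; _*_; -_; _-_)
  open P
  open P.≡-Reasoning
  open import Algebra.Properties.CommutativeSemigroup ℤ.+-commutativeSemigroup
    using () renaming (interchange to +-interchange)

  coeff : Poly → ℕ → ℤ
  coeff []      _       = + 0
  coeff (a ∷ f) zero    = a
  coeff (a ∷ f) (suc i) = coeff f i

  infix 4 _≈ᶜ_
  _≈ᶜ_ : Poly → Poly → Set
  f ≈ᶜ g = ∀ i → coeff f i ≡ coeff g i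

  VanishesFrom : ℕ → Poly → Set
  VanishesFrom N f = ∀ i → N ≤ i → coeff f i ≡ + 0

  IsZero : Poly → Set
  IsZero = VanishesFrom 0

  coeff-addP : ∀ f g i → coeff (addP f g) i ≡ coeff f i + coeff g i
  coeff-addP []      g       i       = sym (ℤ.+-identityˡ _)
  coeff-addP (a ∷ f) []      i       = sym (ℤ.+-identityʳ _)
  coeff-addP (a ∷ f) (b ∷ g) zero    = refl
  coeff-addP (a ∷ f) (b ∷ g) (suc i) = coeff-addP f g i

  coeff-scaleP : ∀ c f i → coeff (scaleP c f) i ≡ c * coeff f i
  coeff-scaleP c []      i       = sym (ℤ.*-zeroʳ c)
  coeff-scaleP c (a ∷ f) zero    = refl
  coeff-scaleP c (a ∷ f) (suc i) = coeff-scaleP c f i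

  coeff-negP : ∀ f i → coeff (negP f) i ≡ - coeff f i
  coeff-negP f i = trans (coeff-scaleP (- + 1) f i) (ℤ.-1*i≡-i (coeff f i))

  coeff-subP : ∀ f g i → coeff (subP f g) i ≡ coeff f i - coeff g i
  coeff-subP f g i = trans (coeff-addP f (negP g) i) (cong (_+_ (coeff f i)) (coeff-negP g i))

  coeff-mulP-zero : ∀ a f g → coeff (mulP (a ∷ f) g) 0 ≡ a * coeff g 0
  coeff-mulP-zero a f g = begin
    coeff (addP (scaleP a g) (+ 0 ∷ mulP f g)) 0  ≡⟨ coeff-addP (scaleP a g) _ 0 ⟩
    coeff (scaleP a g) 0 + + 0                    ≡⟨ ℤ.+-identityʳ _ ⟩
    coeff (scaleP a g) 0                          ≡⟨ coeff-scaleP a g 0 ⟩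
    a * coeff g 0                                 ∎

  coeff-mulP-suc : ∀ a f g i → coeff (mulP (a ∷ f) g) (suc i) ≡ a * coeff g (suc i) + coeff (mulP f g) i
  coeff-mulP-suc a f g i = trans (coeff-addP (scaleP a g) (+ 0 ∷ mulP f g) (suc i))
    (cong (ℤ._+ coeff (mulP f g) i) (coeff-scaleP a g (suc i)))

  coeff-constant-mulP : ∀ c g i → coeff (mulP (c ∷ []) g) i ≡ c * coeff g i
  coeff-constant-mulP c g zero    = coeff-mulP-zero c [] g
  coeff-constant-mulP c g (suc i) = trans (coeff-mulP-suc c [] g i) (ℤ.+-identityʳ _)

  mulP-zeroˡ : ∀ h g → IsZero h → IsZero (mulP h g)
  mulP-zeroˡ []      g h≈0 i       _ = refl
  mulP-zeroˡ (a ∷ h) g h≈0 zero    _ = begin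
    coeff (mulP (a ∷ h) g) 0  ≡⟨ coeff-mulP-zero a h g ⟩
    a * coeff g 0             ≡⟨ cong (ℤ._* coeff g 0) (h≈0 0 z≤n) ⟩
    + 0                       ∎
  mulP-zeroˡ (a ∷ h) g h≈0 (suc i) _ = begin
    coeff (mulP (a ∷ h) g) (suc i)            ≡⟨ coeff-mulP-suc a h g i ⟩
    a * coeff g (suc i) + coeff (mulP h g) i  ≡⟨ cong₂ _+_ (cong (ℤ._* coeff g (suc i)) (h≈0 0 z≤n))
                                                 (mulP-zeroˡ h g (λ j _ → h≈0 (suc j) z≤n) i z≤n) ⟩
    + 0                                       ∎

  mulP-congʳ : ∀ f {g g′} → g ≈ᶜ g′ → mulP f g ≈ᶜ mulP f g′
  mulP-congʳ []      g≈g′ i       = refl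
  mulP-congʳ (a ∷ f) {g} {g′} g≈g′ zero = begin
    coeff (mulP (a ∷ f) g) 0   ≡⟨ coeff-mulP-zero a f g ⟩
    a * coeff g 0              ≡⟨ cong (a *_) (g≈g′ 0) ⟩
    a * coeff g′ 0             ≡⟨ coeff-mulP-zero a f g′ ⟨
    coeff (mulP (a ∷ f) g′) 0  ∎
  mulP-congʳ (a ∷ f) {g} {g′} g≈g′ (suc i) = begin
    coeff (mulP (a ∷ f) g) (suc i)              ≡⟨ coeff-mulP-suc a f g i ⟩
    a * coeff g (suc i) + coeff (mulP f g) i    ≡⟨ cong₂ (λ x y → a * x + y) (g≈g′ (suc i)) (mulP-congʳ f g≈g′ i) ⟩
    a * coeff g′ (suc i) + coeff (mulP f g′) i  ≡⟨ coeff-mulP-suc a f g′ i ⟨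
    coeff (mulP (a ∷ f) g′) (suc i)             ∎

  mulP-congˡ : ∀ f f′ g → f ≈ᶜ f′ → mulP f g ≈ᶜ mulP f′ g
  mulP-congˡ []       []        g f≈f′ i = refl
  mulP-congˡ []       (b ∷ f′)  g f≈f′ i = sym (mulP-zeroˡ (b ∷ f′) g (λ j _ → sym (f≈f′ j)) i z≤n)
  mulP-congˡ (a ∷ f)  []        g f≈f′ i = mulP-zeroˡ (a ∷ f) g (λ j _ → f≈f′ j) i z≤n
  mulP-congˡ (a ∷ f)  (b ∷ f′)  g f≈f′ zero = begin
    coeff (mulP (a ∷ f) g) 0   ≡⟨ coeff-mulP-zero a f g ⟩
    a * coeff g 0              ≡⟨ cong (ℤ._* coeff g 0) (f≈f′ 0) ⟩
    b * coeff g 0              ≡⟨ coeff-mulP-zero b f′ g ⟨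
    coeff (mulP (b ∷ f′) g) 0  ∎
  mulP-congˡ (a ∷ f)  (b ∷ f′)  g f≈f′ (suc i) = begin
    coeff (mulP (a ∷ f) g) (suc i)             ≡⟨ coeff-mulP-suc a f g i ⟩
    a * coeff g (suc i) + coeff (mulP f g) i   ≡⟨ cong₂ (λ x y → x * coeff g (suc i) + y) (f≈f′ 0) (mulP-congˡ f f′ g (λ j → f≈f′ (suc j)) i) ⟩
    b * coeff g (suc i) + coeff (mulP f′ g) i  ≡⟨ coeff-mulP-suc b f′ g i ⟨
    coeff (mulP (b ∷ f′) g) (suc i)            ∎

  mulP-addPˡ : ∀ f f′ g i → coeff (mulP (addP f f′) g) i ≡ coeff (mulP f g) i + coeff (mulP f′ g) i
  mulP-addPˡ []      f′       g i = sym (ℤ.+-identityˡ _)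
  mulP-addPˡ (a ∷ f) []       g i = sym (ℤ.+-identityʳ _)
  mulP-addPˡ (a ∷ f) (b ∷ f′) g zero = begin
    coeff (mulP (a + b ∷ addP f f′) g) 0                  ≡⟨ coeff-mulP-zero (a + b) (addP f f′) g ⟩
    (a + b) * coeff g 0                                   ≡⟨ ℤ.*-distribʳ-+ (coeff g 0) a b ⟩
    a * coeff g 0 + b * coeff g 0                         ≡⟨ cong₂ _+_ (coeff-mulP-zero a f g) (coeff-mulP-zero b f′ g) ⟨
    coeff (mulP (a ∷ f) g) 0 + coeff (mulP (b ∷ f′) g) 0  ∎
  mulP-addPˡ (a ∷ f) (b ∷ f′) g (suc i) = begin
    coeff (mulP (a + b ∷ addP f f′) g) (suc i)                        ≡⟨ coeff-mulP-suc (a + b) (addP f f′) g i ⟩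
    (a + b) * gᵢ + coeff (mulP (addP f f′) g) i                       ≡⟨ cong₂ _+_ (ℤ.*-distribʳ-+ gᵢ a b) (mulP-addPˡ f f′ g i) ⟩
    (a * gᵢ + b * gᵢ) + (coeff (mulP f g) i + coeff (mulP f′ g) i)    ≡⟨ +-interchange (a * gᵢ) (b * gᵢ) (coeff (mulP f g) i) (coeff (mulP f′ g) i) ⟩
    (a * gᵢ + coeff (mulP f g) i) + (b * gᵢ + coeff (mulP f′ g) i)    ≡⟨ cong₂ _+_ (coeff-mulP-suc a f g i) (coeff-mulP-suc b f′ g i) ⟨
    coeff (mulP (a ∷ f) g) (suc i) + coeff (mulP (b ∷ f′) g) (suc i)  ∎
    where gᵢ = coeff g (suc i)

  mulP-negPˡ : ∀ f g i → coeff (mulP (negP f) g) i ≡ - coeff (mulP f g) i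
  mulP-negPˡ []      g i       = refl
  mulP-negPˡ (a ∷ f) g zero    = begin
    coeff (mulP (- + 1 * a ∷ negP f) g) 0  ≡⟨ coeff-mulP-zero (- + 1 * a) (negP f) g ⟩
    (- + 1 * a) * coeff g 0                ≡⟨ minus-one-* a (coeff g 0) ⟩
    - (a * coeff g 0)                      ≡⟨ cong -_ (coeff-mulP-zero a f g) ⟨
    - coeff (mulP (a ∷ f) g) 0             ∎
    where
    minus-one-* : ∀ a x → (- + 1 * a) * x ≡ - (a * x)
    minus-one-* = solve-∀
  mulP-negPˡ (a ∷ f) g (suc i) = begin
    coeff (mulP (- + 1 * a ∷ negP f) g) (suc i)                ≡⟨ coeff-mulP-suc (- + 1 * a) (negP f) g i ⟩
    (- + 1 * a) * coeff g (suc i) + coeff (mulP (negP f) g) i  ≡⟨ cong (_+_ ((- + 1 * a) * coeff g (suc i))) (mulP-negPˡ f g i) ⟩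
    (- + 1 * a) * coeff g (suc i) + - coeff (mulP f g) i       ≡⟨ minus-one-*-+ a (coeff g (suc i)) (coeff (mulP f g) i) ⟩
    - (a * coeff g (suc i) + coeff (mulP f g) i)               ≡⟨ cong -_ (coeff-mulP-suc a f g i) ⟨
    - coeff (mulP (a ∷ f) g) (suc i)                           ∎
    where
    minus-one-*-+ : ∀ a x y → (- + 1 * a) * x + - y ≡ - (a * x + y)
    minus-one-*-+ = solve-∀

  mulP-subPˡ : ∀ f f′ g i → coeff (mulP (subP f f′) g) i ≡ coeff (mulP f g) i - coeff (mulP f′ g) i
  mulP-subPˡ f f′ g i = trans (mulP-addPˡ f (negP f′) g i) (cong (_+_ (coeff (mulP f g) i)) (mulP-negPˡ f′ g i))

  mulP-vanishesFrom : ∀ h g N d → VanishesFrom N h → VanishesFrom (suc d) g → VanishesFrom (N ℕ.+ d) (mulP h g)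
  mulP-vanishesFrom h       g zero    d h≈0 g≈0 i         _         = mulP-zeroˡ h g h≈0 i z≤n
  mulP-vanishesFrom []      g (suc N) d h≈0 g≈0 i         _         = refl
  mulP-vanishesFrom (a ∷ h) g (suc N) d h≈0 g≈0 (suc i) (s≤s N+d≤i) = begin
    coeff (mulP (a ∷ h) g) (suc i)            ≡⟨ coeff-mulP-suc a h g i ⟩
    a * coeff g (suc i) + coeff (mulP h g) i  ≡⟨ cong₂ _+_ (cong (a *_) (g≈0 (suc i) (s≤s (ℕ.≤-trans (ℕ.m≤n+m d N) N+d≤i))))
                                                 (mulP-vanishesFrom h g N d (λ j N≤j → h≈0 (suc j) (s≤s N≤j)) g≈0 i N+d≤i) ⟩
    a * + 0 + + 0                             ≡⟨ cong (_+ + 0) (ℤ.*-zeroʳ a) ⟩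
    + 0                                       ∎

  Monic : ℕ → Poly → Set
  Monic d g = coeff g d ≡ + 1 × VanishesFrom (suc d) g

  coeff-mulP-top : ∀ h g E d → Monic d g → VanishesFrom (suc E) h → coeff (mulP h g) (E ℕ.+ d) ≡ coeff h E
  coeff-mulP-top []      g E       d monic             h≈0 = refl
  coeff-mulP-top (a ∷ h) g zero    zero    (g₀≡1 , _)  h≈0 = begin
    coeff (mulP (a ∷ h) g) 0  ≡⟨ coeff-mulP-zero a h g ⟩
    a * coeff g 0             ≡⟨ cong (a *_) g₀≡1 ⟩
    a * + 1                   ≡⟨ ℤ.*-identityʳ a ⟩
    a                         ∎
  coeff-mulP-top (a ∷ h) g zero    (suc d) (g₁₊d≡1 , _) h≈0 = begin
    coeff (mulP (a ∷ h) g) (suc d)            ≡⟨ coeff-mulP-suc a h g d ⟩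
    a * coeff g (suc d) + coeff (mulP h g) d  ≡⟨ cong₂ _+_ (cong (a *_) g₁₊d≡1) (mulP-zeroˡ h g (λ j _ → h≈0 (suc j) (s≤s z≤n)) d z≤n) ⟩
    a * + 1 + + 0                             ≡⟨ trans (ℤ.+-identityʳ _) (ℤ.*-identityʳ a) ⟩
    a                                         ∎
  coeff-mulP-top (a ∷ h) g (suc E) d monic@(_ , g≈0) h≈0 = begin
    coeff (mulP (a ∷ h) g) (suc (E ℕ.+ d))                    ≡⟨ coeff-mulP-suc a h g (E ℕ.+ d) ⟩
    a * coeff g (suc (E ℕ.+ d)) + coeff (mulP h g) (E ℕ.+ d)  ≡⟨ cong₂ _+_ (cong (a *_) (g≈0 _ (s≤s (ℕ.m≤n+m d E))))
                                                                 (coeff-mulP-top h g E d monic (λ j E<j → h≈0 (suc j) (s≤s E<j))) ⟩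
    a * + 0 + coeff h E                                       ≡⟨ trans (cong (_+ coeff h E) (ℤ.*-zeroʳ a)) (ℤ.+-identityˡ _) ⟩
    coeff h E                                                 ∎

  HasDegree : ℕ → Poly → Set
  HasDegree E f = coeff f E ≢ + 0 × VanishesFrom (suc E) f

  coeff-norm : ∀ f → norm f ≈ᶜ f
  coeff-norm []      i = refl
  coeff-norm (a ∷ f) with norm f | coeff-norm f
  ... | []    | ih with a ℤ.≟ + 0
  ...   | yes a≡0 = λ { zero → sym a≡0 ; (suc i) → ih i }
  ...   | no  _   = λ { zero → refl    ; (suc i) → ih i }
  coeff-norm (a ∷ f) | _ ∷ _ | ih = λ { zero → refl ; (suc i) → ih i }

  norm-lastZ≢0 : ∀ f → norm f ≡ [] ⊎ lastZ (norm f) ≢ + 0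
  norm-lastZ≢0 []      = inj₁ refl
  norm-lastZ≢0 (a ∷ f) with norm f | norm-lastZ≢0 f
  ... | []    | _ with a ℤ.≟ + 0
  ...   | yes _   = inj₁ refl
  ...   | no  a≢0 = inj₂ a≢0
  norm-lastZ≢0 (a ∷ f) | _ ∷ _ | inj₁ ()
  norm-lastZ≢0 (a ∷ f) | _ ∷ _ | inj₂ last≢0 = inj₂ last≢0

  length-norm-≤ : ∀ f → length (norm f) ≤ length f
  length-norm-≤ []      = z≤n
  length-norm-≤ (a ∷ f) with norm f | length-norm-≤ f
  ... | []    | _ with a ℤ.≟ + 0
  ...   | yes _ = z≤n
  ...   | no  _ = s≤s z≤n
  length-norm-≤ (a ∷ f) | _ ∷ _ | ih = s≤s ih

  coeff-length∸1 : ∀ l → coeff l (length l ∸ 1) ≡ lastZ l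
  coeff-length∸1 []          = refl
  coeff-length∸1 (a ∷ [])    = refl
  coeff-length∸1 (a ∷ b ∷ l) = coeff-length∸1 (b ∷ l)

  vanishesFrom-length : ∀ l → VanishesFrom (length l) l
  vanishesFrom-length []      i       _         = refl
  vanishesFrom-length (a ∷ l) (suc i) (s≤s l≤i) = vanishesFrom-length l i l≤i

  length-norm-≤-vanishing : ∀ f N → VanishesFrom N f → length (norm f) ≤ N
  length-norm-≤-vanishing f N f≈0 with norm-lastZ≢0 f
  ... | inj₁ norm≡[] rewrite norm≡[] = z≤n
  ... | inj₂ last≢0 with length (norm f) ℕ.≤? N
  ...   | yes ≤N = ≤N
  ...   | no  ≰N = ⊥-elim (last≢0 (begin
    lastZ (norm f)                        ≡⟨ coeff-length∸1 (norm f) ⟨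
    coeff (norm f) (length (norm f) ∸ 1)  ≡⟨ coeff-norm f _ ⟩
    coeff f (length (norm f) ∸ 1)         ≡⟨ f≈0 _ (ℕ.<⇒≤pred (ℕ.≰⇒> ≰N)) ⟩
    + 0                                   ∎))

  norm-of-degree : ∀ f N → HasDegree N f → length (norm f) ≡ suc N × lastZ (norm f) ≡ coeff f N
  norm-of-degree f N (fN≢0 , f≈0) = length≡ , (begin
    lastZ (norm f)                        ≡⟨ coeff-length∸1 (norm f) ⟨
    coeff (norm f) (length (norm f) ∸ 1)  ≡⟨ cong (λ n → coeff (norm f) (n ∸ 1)) length≡ ⟩
    coeff (norm f) N                      ≡⟨ coeff-norm f N ⟩
    coeff f N                             ∎)
    where
    N<length : N < length (norm f)
    N<length with length (norm f) ℕ.≤? N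
    ... | yes ≤N = ⊥-elim (fN≢0 (trans (sym (coeff-norm f N)) (vanishesFrom-length (norm f) N ≤N)))
    ... | no  ≰N = ℕ.≰⇒> ≰N
    length≡ : length (norm f) ≡ suc N
    length≡ = ℕ.≤-antisym (length-norm-≤-vanishing f (suc N) f≈0) N<length

  zero-or-degree : ∀ h → IsZero h ⊎ Σ ℕ λ E → HasDegree E h
  zero-or-degree h with norm h | norm-lastZ≢0 h | coeff-norm h
  ... | []    | _          | norm≈h = inj₁ (λ i _ → sym (norm≈h i))
  ... | x ∷ r | inj₁ ()    | norm≈h
  ... | x ∷ r | inj₂ last≢0 | norm≈h = inj₂ (length r , top≢0 , λ i r<i → trans (sym (norm≈h i)) (vanishesFrom-length (x ∷ r) i r<i))
    where
    top≢0 : coeff h (length r) ≢ + 0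
    top≢0 hr≡0 = last≢0 (trans (sym (coeff-length∸1 (x ∷ r))) (trans (norm≈h (length r)) hr≡0))

  δ : ℕ → ℕ → ℤ
  δ zero    zero    = + 1
  δ zero    (suc n) = + 0
  δ (suc i) zero    = + 0
  δ (suc i) (suc n) = δ i n

  δ-refl : ∀ n → δ n n ≡ + 1
  δ-refl zero    = refl
  δ-refl (suc n) = δ-refl n

  δ-≢ : ∀ i n → i ≢ n → δ i n ≡ + 0
  δ-≢ zero    zero    i≢n = ⊥-elim (i≢n refl)
  δ-≢ zero    (suc n) i≢n = refl
  δ-≢ (suc i) zero    i≢n = refl
  δ-≢ (suc i) (suc n) i≢n = δ-≢ i n (λ i≡n → i≢n (cong suc i≡n))

  δ-> : ∀ {i n} → n < i → δ i n ≡ + 0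
  δ-> {i} {n} n<i = δ-≢ i n (λ i≡n → ℕ.<-irrefl (sym i≡n) n<i)

  coeff-one : ∀ i → coeff (+ 1 ∷ []) i ≡ δ i 0
  coeff-one zero    = refl
  coeff-one (suc i) = refl

  coeff-powP-q : ∀ n i → coeff (powP qP n) i ≡ δ i n
  coeff-powP-q zero    i       = coeff-one i
  coeff-powP-q (suc n) zero    = coeff-mulP-zero (+ 0) (+ 1 ∷ []) (powP qP n)
  coeff-powP-q (suc n) (suc i) = begin
    coeff (mulP qP (powP qP n)) (suc i)                                      ≡⟨ coeff-mulP-suc (+ 0) (+ 1 ∷ []) (powP qP n) i ⟩
    + 0 * coeff (powP qP n) (suc i) + coeff (mulP (+ 1 ∷ []) (powP qP n)) i  ≡⟨ ℤ.+-identityˡ _ ⟩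
    coeff (mulP (+ 1 ∷ []) (powP qP n)) i                                    ≡⟨ coeff-constant-mulP (+ 1) (powP qP n) i ⟩
    + 1 * coeff (powP qP n) i                                                ≡⟨ ℤ.*-identityˡ _ ⟩
    coeff (powP qP n) i                                                      ≡⟨ coeff-powP-q n i ⟩
    δ i n                                                                    ∎

  monomial : ℤ → ℕ → Poly
  monomial c n = mulP (c ∷ []) (powP qP n)

  coeff-monomial : ∀ c n i → coeff (monomial c n) i ≡ c * δ i n
  coeff-monomial c n i = trans (coeff-constant-mulP c (powP qP n) i) (cong (c *_) (coeff-powP-q n i))

  coeff-q^n-1 : ∀ n i → coeff (subP (powP qP n) (+ 1 ∷ [])) i ≡ δ i n - δ i 0
  coeff-q^n-1 n i = trans (coeff-subP (powP qP n) (+ 1 ∷ []) i) (cong₂ _-_ (coeff-powP-q n i) (coeff-one i))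

  minus-leading-term-vanishesFrom : ∀ h E → VanishesFrom (suc E) h → VanishesFrom E (subP h (monomial (coeff h E) E))
  minus-leading-term-vanishesFrom h E h≈0 i E≤i with i ℕ.≟ E
  ... | yes refl = begin
    coeff (subP h (monomial (coeff h i) i)) i     ≡⟨ coeff-subP h _ i ⟩
    coeff h i - coeff (monomial (coeff h i) i) i
      ≡⟨ cong (_-_ (coeff h i)) (trans (coeff-monomial (coeff h i) i i) (cong (coeff h i *_) (δ-refl i))) ⟩
    coeff h i - coeff h i * + 1                   ≡⟨ x-x*1≡0 (coeff h i) ⟩
    + 0                                           ∎
    where
    x-x*1≡0 : ∀ x → x - x * + 1 ≡ + 0
    x-x*1≡0 = solve-∀
  ... | no  i≢E = begin
    coeff (subP h (monomial (coeff h E) E)) i     ≡⟨ coeff-subP h _ i ⟩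
    coeff h i - coeff (monomial (coeff h E) E) i  ≡⟨ cong₂ _-_ (h≈0 i (ℕ.≤∧≢⇒< E≤i (λ E≡i → i≢E (sym E≡i))))
                                                     (trans (coeff-monomial (coeff h E) E i) (cong (coeff h E *_) (δ-≢ i E i≢E))) ⟩
    + 0 - coeff h E * + 0                         ≡⟨ 0-x*0≡0 (coeff h E) ⟩
    + 0                                           ∎
    where
    0-x*0≡0 : ∀ x → + 0 - x * + 0 ≡ + 0
    0-x*0≡0 = solve-∀

  degree-mulP : ∀ h g E d → Monic d g → HasDegree E h → HasDegree (E ℕ.+ d) (mulP h g)
  degree-mulP h g E d monic@(_ , g≈0) (hE≢0 , h≈0) =
    (λ top≡0 → hE≢0 (trans (sym (coeff-mulP-top h g E d monic h≈0)) top≡0)) ,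
    mulP-vanishesFrom h g (suc E) d h≈0 g≈0

  length-norm-monic : ∀ g d → Monic d g → length (norm g) ≡ suc d
  length-norm-monic g d (g≡1 , g≈0) = proj₁ (norm-of-degree g d ((λ g≡0 → 1≢0 (trans (sym g≡1) g≡0)) , g≈0))
    where
    1≢0 : + 1 ≢ + 0
    1≢0 ()

  degree-of-multiple : ∀ f g h E d → Monic d g → HasDegree E h → f ≈ᶜ mulP h g → HasDegree (E ℕ.+ d) f
  degree-of-multiple f g h E d monic degE f≈hg with degree-mulP h g E d monic degE
  ... | hgE≢0 , hg≈0 = (λ fE≡0 → hgE≢0 (trans (sym (f≈hg _)) fE≡0)) , λ i E<i → trans (f≈hg i) (hg≈0 i E<i)

  divMonicF-correct : ∀ fuel f g h d → Monic d g → f ≈ᶜ mulP h g → length (norm f) < fuel ℕ.+ suc d →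
                      divMonicF fuel f g ≈ᶜ h
  divMonicF-correct fuel f g h d monic f≈hg bound with zero-or-degree h
  divMonicF-correct zero f g h d monic f≈hg bound | inj₁ h≈0 = λ i → sym (h≈0 i z≤n)
  divMonicF-correct (suc fuel) f g h d monic f≈hg bound | inj₁ h≈0
    with norm f | norm g in eg | length-norm-≤-vanishing f 0 (λ i _ → trans (f≈hg i) (mulP-zeroˡ h g h≈0 i z≤n))
  ... | f′ | g′ | f′≤0 with length f′ ℕ.<? length g′
  ...   | yes _     = λ i → sym (h≈0 i z≤n)
  ...   | no  f′≮g′ = ⊥-elim (f′≮g′ (ℕ.≤-<-trans f′≤0 (subst (0 <_) g′-length (s≤s z≤n))))
    where g′-length = trans (sym (length-norm-monic g d monic)) (cong length eg)
  divMonicF-correct zero f g h d monic f≈hg bound | inj₂ (E , degE) =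
    ⊥-elim (ℕ.<-irrefl refl (ℕ.<-≤-trans (subst (_< suc d) f-length bound) (s≤s (ℕ.m≤n+m d E))))
    where f-length = proj₁ (norm-of-degree f (E ℕ.+ d) (degree-of-multiple f g h E d monic degE f≈hg))
  divMonicF-correct (suc fuel) f g h d monic@(_ , g≈0) f≈hg bound | inj₂ (E , degE@(_ , h≈0))
    with norm f in ef | norm g in eg | norm-of-degree f (E ℕ.+ d) (degree-of-multiple f g h E d monic degE f≈hg)
  ... | f′ | g′ | f′-length , f′-last with length f′ ℕ.<? length g′
  ...   | yes f′<g′ = ⊥-elim (ℕ.<-irrefl refl (ℕ.<-≤-trans (subst₂ _<_ f′-length g′-length f′<g′) (s≤s (ℕ.m≤n+m d E))))
    where g′-length = trans (sym (cong length eg)) (length-norm-monic g d monic)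
  ...   | no  _ = λ i → begin
    coeff (addP term (divMonicF fuel f″ g)) i     ≡⟨ coeff-addP term _ i ⟩
    coeff term i + coeff (divMonicF fuel f″ g) i  ≡⟨ cong (_+_ (coeff term i)) (quotient-correct i) ⟩
    coeff term i + coeff (subP h term) i          ≡⟨ cong (_+_ (coeff term i)) (coeff-subP h term i) ⟩
    coeff term i + (coeff h i - coeff term i)     ≡⟨ x+[y-x]≡y (coeff term i) (coeff h i) ⟩
    coeff h i                                     ∎
    where
    x+[y-x]≡y : ∀ x y → x + (y - x) ≡ y
    x+[y-x]≡y = solve-∀
    term = mulP (lastZ f′ ∷ []) (powP qP (length f′ ∸ length g′))
    term≡leading : term ≡ monomial (coeff h E) E
    term≡leading = cong₂ monomial (trans f′-last (trans (f≈hg _) (coeff-mulP-top h g E d monic h≈0)))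
                                  (trans (cong₂ _∸_ f′-length (trans (sym (cong length eg)) (length-norm-monic g d monic))) (ℕ.m+n∸n≡m E d))
    f″ = subP f′ (mulP term g′)
    f″≈ : f″ ≈ᶜ mulP (subP h term) g
    f″≈ i = begin
      coeff (subP f′ (mulP term g′)) i            ≡⟨ coeff-subP f′ _ i ⟩
      coeff f′ i - coeff (mulP term g′) i         ≡⟨ cong₂ _-_ (trans (cong (λ l → coeff l i) (sym ef)) (trans (coeff-norm f i) (f≈hg i)))
                                                     (mulP-congʳ term (λ j → trans (cong (λ l → coeff l j) (sym eg)) (coeff-norm g j)) i) ⟩
      coeff (mulP h g) i - coeff (mulP term g) i  ≡⟨ mulP-subPˡ h term g i ⟨
      coeff (mulP (subP h term) g) i              ∎
    remainder-vanishes : VanishesFrom E (subP h term)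
    remainder-vanishes rewrite term≡leading = minus-leading-term-vanishesFrom h E h≈0
    quotient-correct : divMonicF fuel f″ g ≈ᶜ subP h term
    quotient-correct = divMonicF-correct fuel f″ g (subP h term) d monic f″≈
      (ℕ.≤-<-trans (length-norm-≤-vanishing f″ (E ℕ.+ d) (λ i le → trans (f″≈ i) (mulP-vanishesFrom (subP h term) g E d remainder-vanishes g≈0 i le)))
                   (ℕ.s≤s⁻¹ (subst (_< suc fuel ℕ.+ suc d) f′-length bound)))

  divMonic-correct : ∀ f g h d → Monic d g → f ≈ᶜ mulP h g → divMonic f g ≈ᶜ h
  divMonic-correct f g h d monic f≈hg = divMonicF-correct (suc (length f)) f g h d monic f≈hg
    (ℕ.≤-<-trans (length-norm-≤ f) (s≤s (ℕ.m≤m+n (length f) (suc d))))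

  ≈P⇒≈ᶜ : ∀ f g → f ≈P g → f ≈ᶜ g
  ≈P⇒≈ᶜ f g f≈g i = P.trans (P.sym (coeff-norm f i)) (P.trans (P.cong (λ l → coeff l i) f≈g) (coeff-norm g i))

open PolynomialCoefficients

module ProperDivisors where
  open P
  open P.≡-Reasoning

  applyUpTo-+ : ∀ (f : ℕ → ℕ) m n → applyUpTo f (m ℕ.+ n) ≡ applyUpTo f m ++ applyUpTo (λ i → f (m ℕ.+ i)) n
  applyUpTo-+ f zero    n = refl
  applyUpTo-+ f (suc m) n = cong (f 0 ∷_) (applyUpTo-+ (λ i → f (suc i)) m n)

  filter-∣-applyUpTo-none : ∀ N (f : ℕ → ℕ) n → (∀ i → i < n → ¬ (f i ∣ N)) → filter (_∣? N) (applyUpTo f n) ≡ []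
  filter-∣-applyUpTo-none N f n none = List.filter-none (_∣? N) (go f n none)
    where
    go : ∀ (f : ℕ → ℕ) n → (∀ i → i < n → ¬ (f i ∣ N)) → All (λ d → ¬ (d ∣ N)) (applyUpTo f n)
    go f zero    none = []
    go f (suc n) none = none 0 (s≤s z≤n) ∷ go (λ i → f (suc i)) n (λ i i<n → none (suc i) (s≤s i<n))

  properDivisors-prime : ∀ {p} → Prime p → properDivisors p ≡ 1 ∷ []
  properDivisors-prime {suc (suc m)} p-prime = begin
    filter (_∣? p) (map suc (upTo (suc m)))               ≡⟨ cong (filter (_∣? p)) (List.map-upTo suc (suc m)) ⟩
    filter (_∣? p) (1 ∷ applyUpTo (λ i → suc (suc i)) m)  ≡⟨ List.filter-accept (_∣? p) (1∣ p) ⟩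
    1 ∷ filter (_∣? p) (applyUpTo (λ i → suc (suc i)) m)  ≡⟨ cong (1 ∷_) (filter-∣-applyUpTo-none p _ m no-divisor) ⟩
    1 ∷ []                                                ∎
    where
    p = suc (suc m)
    no-divisor : ∀ i → i < m → ¬ (suc (suc i) ∣ p)
    no-divisor i i<m d∣p with prime⇒irreducible p-prime d∣p
    ... | inj₁ ()
    ... | inj₂ d≡p = ℕ.<-irrefl (cong (λ x → pred (pred x)) d≡p) i<m

  proper-divisor-of-2p : ∀ {p} → Prime p → ∀ d → 0 < d → d < 2 ℕ.* p → d ∣ 2 ℕ.* p → d ≡ 1 ⊎ d ≡ 2 ⊎ d ≡ p
  proper-divisor-of-2p {p} p-prime d 0<d d<2p (divides k 2p≡kd) with euclidsLemma k d p-prime (divides 2 (sym 2p≡kd))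
  ... | inj₂ (divides j d≡jp) = inj₂ (inj₂ (multiple-of-p j d≡jp))
    where
    multiple-of-p : ∀ j → d ≡ j ℕ.* p → d ≡ p
    multiple-of-p zero          d≡0  = ⊥-elim (ℕ.<-irrefl (sym d≡0) 0<d)
    multiple-of-p (suc zero)    d≡p  = trans d≡p (ℕ.+-identityʳ p)
    multiple-of-p (suc (suc j)) d≡jp = ⊥-elim (ℕ.<-irrefl refl (ℕ.<-≤-trans d<2p
      (subst (2 ℕ.* p ≤_) (sym d≡jp) (ℕ.*-monoˡ-≤ p {2} {suc (suc j)} (s≤s (s≤s z≤n))))))
  ... | inj₁ (divides j k≡jp) = at-most-two d 0<d (∣⇒≤ (divides j 2≡jd))
    where
    instance
      _ : NonZero p
      _ = prime⇒nonZero p-prime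
    2≡jd : 2 ≡ j ℕ.* d
    2≡jd = ℕ.*-cancelʳ-≡ 2 (j ℕ.* d) p (begin
      2 ℕ.* p          ≡⟨ 2p≡kd ⟩
      k ℕ.* d          ≡⟨ cong (ℕ._* d) k≡jp ⟩
      j ℕ.* p ℕ.* d    ≡⟨ ℕ.*-assoc j p d ⟩
      j ℕ.* (p ℕ.* d)  ≡⟨ cong (j ℕ.*_) (ℕ.*-comm p d) ⟩
      j ℕ.* (d ℕ.* p)  ≡⟨ ℕ.*-assoc j d p ⟨
      j ℕ.* d ℕ.* p    ∎)
    at-most-two : ∀ d → 0 < d → d ≤ 2 → d ≡ 1 ⊎ d ≡ 2 ⊎ d ≡ p
    at-most-two 1 _ _ = inj₁ refl
    at-most-two 2 _ _ = inj₂ (inj₁ refl)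
    at-most-two (suc (suc (suc d))) _ (s≤s (s≤s ()))

  properDivisors-2p : ∀ {r} → let p = 3 ℕ.+ r in Prime p → properDivisors (2 ℕ.* p) ≡ 1 ∷ 2 ∷ p ∷ []
  properDivisors-2p {r} p-prime = begin
    filter P? (map suc (upTo (2 ℕ.* p ∸ 1)))                               ≡⟨ cong (filter P?) (List.map-upTo suc (2 ℕ.* p ∸ 1)) ⟩
    filter P? (applyUpTo suc (2 ℕ.* p ∸ 1))
      ≡⟨ cong (λ n → filter P? (applyUpTo suc (2 ℕ.+ (r ℕ.+ (3 ℕ.+ n))))) (ℕ.+-identityʳ r) ⟩
    filter P? (1 ∷ 2 ∷ applyUpTo g (r ℕ.+ (3 ℕ.+ r)))                      ≡⟨ List.filter-accept P? (1∣ 2p) ⟩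
    1 ∷ filter P? (2 ∷ applyUpTo g (r ℕ.+ (3 ℕ.+ r)))                      ≡⟨ cong (1 ∷_) (List.filter-accept P? (divides p (ℕ.*-comm 2 p))) ⟩
    1 ∷ 2 ∷ filter P? (applyUpTo g (r ℕ.+ (3 ℕ.+ r)))                      ≡⟨ cong (λ l → 1 ∷ 2 ∷ filter P? l) (applyUpTo-+ g r (3 ℕ.+ r)) ⟩
    1 ∷ 2 ∷ filter P? (applyUpTo g r ++ (g (r ℕ.+ 0) ∷ rest))              ≡⟨ cong (λ l → 1 ∷ 2 ∷ l) (List.filter-++ P? (applyUpTo g r) _) ⟩
    1 ∷ 2 ∷ (filter P? (applyUpTo g r) ++ filter P? (g (r ℕ.+ 0) ∷ rest))
      ≡⟨ cong₂ (λ l m → 1 ∷ 2 ∷ (l ++ m)) (filter-∣-applyUpTo-none 2p g r below-p)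
         (trans (List.filter-accept P? (subst (_∣ 2p) (sym g[r+0]≡p) (divides 2 refl)))
         (cong₂ _∷_ g[r+0]≡p (filter-∣-applyUpTo-none 2p _ (2 ℕ.+ r) above-p))) ⟩
    1 ∷ 2 ∷ p ∷ []                                                         ∎
    where
    p  = 3 ℕ.+ r
    2p = 2 ℕ.* p
    P? = _∣? 2p
    g : ℕ → ℕ
    g i = 3 ℕ.+ i
    rest = applyUpTo (λ i → g (r ℕ.+ suc i)) (2 ℕ.+ r)
    g[r+0]≡p : g (r ℕ.+ 0) ≡ p
    g[r+0]≡p = cong g (ℕ.+-identityʳ r)
    2p≡ : 2p ≡ g (r ℕ.+ g r)
    2p≡ = cong (λ n → g (r ℕ.+ g n)) (ℕ.+-identityʳ r)
    below-p : ∀ i → i < r → ¬ (g i ∣ 2p)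
    below-p i i<r gi∣2p
      with proper-divisor-of-2p p-prime (g i) (s≤s z≤n) (subst (g i <_) (sym 2p≡) (s≤s (s≤s (s≤s (ℕ.≤-trans i<r (ℕ.m≤m+n r (g r))))))) gi∣2p
    ... | inj₁ ()
    ... | inj₂ (inj₁ ())
    ... | inj₂ (inj₂ gi≡p) = ℕ.<-irrefl (cong (λ x → pred (pred (pred x))) gi≡p) i<r
    above-p : ∀ i → i < 2 ℕ.+ r → ¬ (g (r ℕ.+ suc i) ∣ 2p)
    above-p i i<2+r gi∣2p
      with proper-divisor-of-2p p-prime (g (r ℕ.+ suc i)) (s≤s z≤n)
             (subst (g (r ℕ.+ suc i) <_) (sym 2p≡) (s≤s (s≤s (s≤s (ℕ.+-monoʳ-< r {suc i} {g r} (s≤s i<2+r)))))) gi∣2p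
    ... | inj₁ ()
    ... | inj₂ (inj₁ ())
    ... | inj₂ (inj₂ gi≡p) = ℕ.m+1+n≢m r (cong (λ x → pred (pred (pred x))) gi≡p)

open ProperDivisors

module Cyclotomic where
  open import Data.Integer using (_+_; _*_; -_; _-_)
  open P
  open P.≡-Reasoning

  mulP-oneʳ : ∀ f → mulP f (+ 1 ∷ []) ≈ᶜ f
  mulP-oneʳ []      i       = refl
  mulP-oneʳ (a ∷ f) zero    = trans (coeff-mulP-zero a f (+ 1 ∷ [])) (ℤ.*-identityʳ a)
  mulP-oneʳ (a ∷ f) (suc i) = begin
    coeff (mulP (a ∷ f) (+ 1 ∷ [])) (suc i)  ≡⟨ coeff-mulP-suc a f (+ 1 ∷ []) i ⟩
    a * + 0 + coeff (mulP f (+ 1 ∷ [])) i    ≡⟨ cong₂ _+_ (ℤ.*-zeroʳ a) (mulP-oneʳ f i) ⟩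
    + 0 + coeff f i                          ≡⟨ ℤ.+-identityˡ _ ⟩
    coeff f i                                ∎

  q-1 q+1 : Poly
  q-1 = -[1+ 0 ] ∷ + 1 ∷ []
  q+1 = + 1 ∷ + 1 ∷ []

  q^n-1 : ℕ → Poly
  q^n-1 n = subP (powP qP n) (+ 1 ∷ [])

  cycF-1 : ∀ fuel → cycF (suc fuel) 1 ≈ᶜ q-1
  cycF-1 fuel = ≈P⇒≈ᶜ (cycF (suc fuel) 1) q-1 refl

  cycF-2 : ∀ fuel → cycF (2 ℕ.+ fuel) 2 ≈ᶜ q+1
  cycF-2 fuel = ≈P⇒≈ᶜ (cycF (2 ℕ.+ fuel) 2) q+1 refl

  ones : ℕ → Poly
  ones zero    = []
  ones (suc k) = + 1 ∷ ones k

  δ< : ℕ → ℕ → ℤ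
  δ< zero    zero    = + 0
  δ< zero    (suc k) = + 1
  δ< (suc i) zero    = + 0
  δ< (suc i) (suc k) = δ< i k

  coeff-ones : ∀ k i → coeff (ones k) i ≡ δ< i k
  coeff-ones zero    zero    = refl
  coeff-ones zero    (suc i) = refl
  coeff-ones (suc k) zero    = refl
  coeff-ones (suc k) (suc i) = coeff-ones k i

  δ<-zero : ∀ i → δ< i 0 ≡ + 0
  δ<-zero zero    = refl
  δ<-zero (suc i) = refl

  δ<-suc : ∀ i n → δ< i (suc n) ≡ δ< i n + δ i n
  δ<-suc zero    zero    = refl
  δ<-suc zero    (suc n) = refl
  δ<-suc (suc i) zero    = δ<-zero i
  δ<-suc (suc i) (suc n) = δ<-suc i n

  ones-*-q-1 : ∀ g → g ≈ᶜ q-1 → ∀ k i → coeff (mulP (ones k) g) i ≡ δ i k - δ i 0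
  ones-*-q-1 g g≈ zero    i       = sym (ℤ.+-inverseʳ (δ i 0))
  ones-*-q-1 g g≈ (suc k) zero    = trans (coeff-mulP-zero (+ 1) (ones k) g) (cong (+ 1 *_) (g≈ 0))
  ones-*-q-1 g g≈ (suc k) (suc j) = begin
    coeff (mulP (ones (suc k)) g) (suc j)              ≡⟨ coeff-mulP-suc (+ 1) (ones k) g j ⟩
    + 1 * coeff g (suc j) + coeff (mulP (ones k) g) j  ≡⟨ cong₂ (λ x y → + 1 * x + y) (trans (g≈ (suc j)) (coeff-one j)) (ones-*-q-1 g g≈ k j) ⟩
    + 1 * δ j 0 + (δ j k - δ j 0)                      ≡⟨ telescope (δ j 0) (δ j k) ⟩
    δ j k - + 0                                        ∎
    where
    telescope : ∀ x y → + 1 * x + (y - x) ≡ y - + 0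
    telescope = solve-∀

  cycF-prime : ∀ fuel {p} → Prime p → cycF (suc (suc fuel)) p ≈ᶜ ones p
  cycF-prime fuel {p} p-prime i = begin
    coeff (divMonic (q^n-1 p) (foldr (λ d acc → mulP (cycF (suc fuel) d) acc) (+ 1 ∷ []) (properDivisors p))) i
      ≡⟨ cong (λ ds → coeff (divMonic (q^n-1 p) (foldr (λ d acc → mulP (cycF (suc fuel) d) acc) (+ 1 ∷ []) ds)) i) (properDivisors-prime p-prime) ⟩
    coeff (divMonic (q^n-1 p) g) i  ≡⟨ divMonic-correct (q^n-1 p) g (ones p) 1 monic (λ i → trans (coeff-q^n-1 p i) (sym (ones-*-q-1 g g≈ p i))) i ⟩
    coeff (ones p) i                ∎
    where
    g = mulP (cycF (suc fuel) 1) (+ 1 ∷ [])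
    g≈ : g ≈ᶜ q-1
    g≈ = ≈P⇒≈ᶜ g q-1 refl
    monic : Monic 1 g
    monic = g≈ 1 , λ { (suc (suc i)) _ → g≈ (suc (suc i)) ; (suc zero) (s≤s ()) }

  coeff-linear-mulP-suc : ∀ a b f i → coeff (mulP (a ∷ b ∷ []) f) (suc i) ≡ a * coeff f (suc i) + b * coeff f i
  coeff-linear-mulP-suc a b f i = trans (coeff-mulP-suc a (b ∷ []) f i) (cong (_+_ (a * coeff f (suc i))) (coeff-constant-mulP b f i))

  alt-sign : ℕ → ℤ
  alt-sign zero    = + 1
  alt-sign (suc k) = - alt-sign k

  alternating : ℕ → Poly
  alternating zero    = []
  alternating (suc k) = + 1 ∷ negP (alternating k)

  alt-sign-parity : ∀ n → (alt-sign n ≡ + 1 × Σ ℕ λ k → n ≡ k ℕ.+ k) ⊎ (alt-sign n ≡ -[1+ 0 ] × Σ ℕ λ k → n ≡ suc (k ℕ.+ k))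
  alt-sign-parity zero = inj₁ (refl , 0 , refl)
  alt-sign-parity (suc n) with alt-sign-parity n
  ... | inj₁ (sign≡ , k , n≡) = inj₂ (cong -_ sign≡ , k , cong suc n≡)
  ... | inj₂ (sign≡ , k , n≡) = inj₁ (cong -_ sign≡ , suc k , cong suc (trans n≡ (sym (ℕ.+-suc k k))))

  odd-prime : ∀ r → Prime (3 ℕ.+ r) → alt-sign (3 ℕ.+ r) ≡ -[1+ 0 ] × Σ ℕ λ k → 3 ℕ.+ r ≡ suc (k ℕ.+ k)
  odd-prime r p-prime with alt-sign-parity (3 ℕ.+ r)
  ... | inj₂ odd = odd
  ... | inj₁ (_ , k , p≡k+k) with prime⇒irreducible p-prime (divides k (trans p≡k+k (trans (cong (k ℕ.+_) (sym (ℕ.+-identityʳ k))) (ℕ.*-comm 2 k))))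
  ...   | inj₁ ()
  ...   | inj₂ ()

  alternating-* : ∀ m G → (∀ i → coeff G i ≡ δ i (suc m) + δ i m - δ i 1 - δ i 0) → ∀ k i →
                  coeff (mulP (alternating k) G) i ≡ δ i m - δ i 0 - alt-sign k * δ i (k ℕ.+ m) + alt-sign k * δ i k
  alternating-* m G G≈ zero    i       = 0≡a-b-a+b (δ i m) (δ i 0)
    where
    0≡a-b-a+b : ∀ a b → + 0 ≡ a - b - + 1 * a + + 1 * b
    0≡a-b-a+b = solve-∀
  alternating-* m G G≈ (suc k) zero    = begin
    coeff (mulP (alternating (suc k)) G) 0                         ≡⟨ coeff-mulP-zero (+ 1) (negP (alternating k)) G ⟩
    + 1 * coeff G 0                                                ≡⟨ cong (+ 1 *_) (G≈ 0) ⟩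
    + 1 * (+ 0 + δ 0 m - + 0 - + 1)                                ≡⟨ constant-term (δ 0 m) (alt-sign (suc k)) ⟩
    δ 0 m - + 1 - alt-sign (suc k) * + 0 + alt-sign (suc k) * + 0  ∎
    where
    constant-term : ∀ x s → + 1 * (+ 0 + x - + 0 - + 1) ≡ x - + 1 - s * + 0 + s * + 0
    constant-term = solve-∀
  alternating-* m G G≈ (suc k) (suc j) = begin
    coeff (mulP (alternating (suc k)) G) (suc j)                     ≡⟨ coeff-mulP-suc (+ 1) (negP (alternating k)) G j ⟩
    + 1 * coeff G (suc j) + coeff (mulP (negP (alternating k)) G) j
      ≡⟨ cong₂ (λ x y → + 1 * x + y) (G≈ (suc j)) (trans (mulP-negPˡ (alternating k) G j) (cong -_ (alternating-* m G G≈ k j))) ⟩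
    + 1 * (δ (suc j) (suc m) + δ (suc j) m - δ (suc j) 1 - + 0)
      + - (δ j m - δ j 0 - alt-sign k * δ j (k ℕ.+ m) + alt-sign k * δ j k) ≡⟨ shift (δ j m) (δ (suc j) m) (δ j 0) (δ j (k ℕ.+ m)) (δ j k) (alt-sign k) ⟩
    δ (suc j) m - + 0 - alt-sign (suc k) * δ j (k ℕ.+ m) + alt-sign (suc k) * δ j k  ∎
    where
    shift : ∀ a b c d e s → + 1 * (a + b - c - + 0) + - (a - c - s * d + s * e) ≡ b - + 0 - (- s) * d + (- s) * e
    shift = solve-∀

  module _ (r : ℕ) (p-prime : Prime (3 ℕ.+ r)) where
    -- Unfolded, Φ (2 p) = cycF (2 p) (2 p) divides q²ᵖ − 1 by G = Φ₁ Φ₂ Φₚ, each computed with fuel 2 p − 1.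
    private
      p = 3 ℕ.+ r
      fuel = pred (2 ℕ.* p)
      Z = mulP (cycF fuel p) (+ 1 ∷ [])
      Y = mulP (cycF fuel 2) Z
      G = mulP (cycF fuel 1) Y

      coeff-Z : ∀ i → coeff Z i ≡ δ< i p
      coeff-Z i = trans (mulP-oneʳ (cycF fuel p) i) (trans (cycF-prime (pred (pred fuel)) p-prime i) (coeff-ones p i))

      coeff-Y-zero : coeff Y 0 ≡ + 1 * δ< 0 p
      coeff-Y-zero = trans (mulP-congˡ (cycF fuel 2) q+1 Z (cycF-2 (pred (pred fuel))) 0) (trans (coeff-mulP-zero (+ 1) (+ 1 ∷ []) Z) (cong (+ 1 *_) (coeff-Z 0)))

      coeff-Y-suc : ∀ i → coeff Y (suc i) ≡ + 1 * δ< (suc i) p + + 1 * δ< i p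
      coeff-Y-suc i = trans (mulP-congˡ (cycF fuel 2) q+1 Z (cycF-2 (pred (pred fuel))) (suc i))
        (trans (coeff-linear-mulP-suc (+ 1) (+ 1) Z i) (cong₂ (λ x y → + 1 * x + + 1 * y) (coeff-Z (suc i)) (coeff-Z i)))

      coeff-G-zero : coeff G 0 ≡ -[1+ 0 ] * coeff Y 0
      coeff-G-zero = trans (mulP-congˡ (cycF fuel 1) q-1 Y (cycF-1 (pred fuel)) 0) (coeff-mulP-zero -[1+ 0 ] (+ 1 ∷ []) Y)

      coeff-G-suc : ∀ i → coeff G (suc i) ≡ -[1+ 0 ] * coeff Y (suc i) + + 1 * coeff Y i
      coeff-G-suc i = trans (mulP-congˡ (cycF fuel 1) q-1 Y (cycF-1 (pred fuel)) (suc i)) (coeff-linear-mulP-suc -[1+ 0 ] (+ 1) Y i)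

      coeff-G : ∀ i → coeff G i ≡ δ i (suc p) + δ i p - δ i 1 - δ i 0
      coeff-G zero          = trans coeff-G-zero (cong (-[1+ 0 ] *_) coeff-Y-zero)
      coeff-G (suc zero)    = trans (coeff-G-suc 0) (cong₂ (λ x y → -[1+ 0 ] * x + + 1 * y) (coeff-Y-suc 0) coeff-Y-zero)
      coeff-G (suc (suc j)) = begin
        coeff G (2 ℕ.+ j)                                     ≡⟨ coeff-G-suc (suc j) ⟩
        -[1+ 0 ] * coeff Y (2 ℕ.+ j) + + 1 * coeff Y (suc j)  ≡⟨ cong₂ (λ x y → -[1+ 0 ] * x + + 1 * y) (coeff-Y-suc (suc j)) (coeff-Y-suc j) ⟩
        -[1+ 0 ] * (+ 1 * a + + 1 * δ< j (2 ℕ.+ r)) + + 1 * (+ 1 * δ< j (2 ℕ.+ r) + + 1 * δ< j (3 ℕ.+ r))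
          ≡⟨ cong₂ (λ b c → -[1+ 0 ] * (+ 1 * a + + 1 * b) + + 1 * (+ 1 * b + + 1 * c))
             (δ<-suc j (1 ℕ.+ r)) (trans (δ<-suc j (2 ℕ.+ r)) (cong (_+ x) (δ<-suc j (1 ℕ.+ r)))) ⟩
        -[1+ 0 ] * (+ 1 * a + + 1 * (a + y)) + + 1 * (+ 1 * (a + y) + + 1 * ((a + y) + x))
          ≡⟨ telescope a y x ⟩
        x + y - + 0 - + 0                                     ∎
        where
        a = δ< j (1 ℕ.+ r)
        y = δ j (1 ℕ.+ r)
        x = δ j (2 ℕ.+ r)
        telescope : ∀ a y x → -[1+ 0 ] * (+ 1 * a + + 1 * (a + y)) + + 1 * (+ 1 * (a + y) + + 1 * ((a + y) + x)) ≡ x + y - + 0 - + 0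
        telescope = solve-∀

      G-monic : Monic (suc p) G
      G-monic = top , above
        where
        top : coeff G (suc p) ≡ + 1
        top = trans (coeff-G (suc p)) (cong₂ (λ x y → x + y - + 0 - + 0) (δ-refl (suc p)) (δ-≢ (suc p) p ℕ.1+n≢n))
        above : VanishesFrom (2 ℕ.+ p) G
        above i p+1<i = trans (coeff-G i)
          (cong₂ _-_ (cong₂ _-_ (cong₂ _+_ (δ-> p+1<i) (δ-> (ℕ.<-trans (ℕ.n<1+n p) p+1<i)))
                                (δ-> (ℕ.<-≤-trans (s≤s (s≤s z≤n)) p+1<i)))
                     (δ-> (ℕ.<-≤-trans (s≤s z≤n) p+1<i)))

      q^2p-1≈alternating*G : q^n-1 (2 ℕ.* p) ≈ᶜ mulP (alternating p) G
      q^2p-1≈alternating*G i = begin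
        coeff (q^n-1 (2 ℕ.* p)) i                                        ≡⟨ coeff-q^n-1 (2 ℕ.* p) i ⟩
        δ i (2 ℕ.* p) - δ i 0                                            ≡⟨ cong (λ n → δ i (p ℕ.+ n) - δ i 0) (ℕ.+-identityʳ p) ⟩
        δ i (p ℕ.+ p) - δ i 0                                            ≡⟨ telescope (δ i p) (δ i 0) (δ i (p ℕ.+ p)) ⟨
        δ i p - δ i 0 - -[1+ 0 ] * δ i (p ℕ.+ p) + -[1+ 0 ] * δ i p
          ≡⟨ cong (λ s → δ i p - δ i 0 - s * δ i (p ℕ.+ p) + s * δ i p) (proj₁ (odd-prime r p-prime)) ⟨
        δ i p - δ i 0 - alt-sign p * δ i (p ℕ.+ p) + alt-sign p * δ i p  ≡⟨ alternating-* p G coeff-G p i ⟨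
        coeff (mulP (alternating p) G) i                                 ∎
        where
        telescope : ∀ a b c → a - b - -[1+ 0 ] * c + -[1+ 0 ] * a ≡ c - b
        telescope = solve-∀

    cycF-2p : Φ (2 ℕ.* p) ≈ᶜ alternating p
    cycF-2p i = begin
      coeff (divMonic (q^n-1 (2 ℕ.* p)) (foldr (λ d acc → mulP (cycF fuel d) acc) (+ 1 ∷ []) (properDivisors (2 ℕ.* p)))) i
        ≡⟨ cong (λ ds → coeff (divMonic (q^n-1 (2 ℕ.* p)) (foldr (λ d acc → mulP (cycF fuel d) acc) (+ 1 ∷ []) ds)) i) (properDivisors-2p p-prime) ⟩
      coeff (divMonic (q^n-1 (2 ℕ.* p)) G) i  ≡⟨ divMonic-correct (q^n-1 (2 ℕ.* p)) G (alternating p) (suc p) G-monic q^2p-1≈alternating*G i ⟩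
      coeff (alternating p) i                 ∎

open Cyclotomic

module AtomExpansion where
  open import Data.Integer using (_+_; _*_; -_; _-_)
  open P
  open P.≡-Reasoning

  expansionTerm : ℕ → ℕ → Poly
  expansionTerm j e = mulP (powP qP j) (powP q+1 e)

  WellIndexed : ℕ → ℕ → List ℤ → Set
  WellIndexed m j γ = ∀ l → l < length γ → 2 ℕ.* (j ℕ.+ l) ≤ m

  WellIndexed-tail : ∀ m j g γ → WellIndexed m j (g ∷ γ) → WellIndexed m (suc j) γ
  WellIndexed-tail m j g γ wi l l<γ = subst (λ x → 2 ℕ.* x ≤ m) (ℕ.+-suc j l) (wi (suc l) (s≤s l<γ))

  WellIndexed-head : ∀ m j g γ → WellIndexed m j (g ∷ γ) → m ≡ j ℕ.+ (m ∸ 2 ℕ.* j) ℕ.+ j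
  WellIndexed-head m j g γ wi = trans (sym (ℕ.m∸n+n≡m 2j≤m)) (rearrange (m ∸ 2 ℕ.* j) j)
    where
    2j≤m : 2 ℕ.* j ≤ m
    2j≤m = subst (λ x → 2 ℕ.* x ≤ m) (ℕ.+-identityʳ j) (wi 0 (s≤s z≤n))
    rearrange : ∀ u j → u ℕ.+ 2 ℕ.* j ≡ j ℕ.+ u ℕ.+ j
    rearrange = ℕ-solve-∀

  coeff-mulP-at-0 : ∀ h g → coeff (mulP h g) 0 ≡ coeff h 0 * coeff g 0
  coeff-mulP-at-0 []      g = sym (ℤ.*-zeroˡ (coeff g 0))
  coeff-mulP-at-0 (a ∷ h) g = coeff-mulP-zero a h g

  q+1-monic : Monic 1 q+1
  q+1-monic = refl , λ { (suc (suc i)) _ → refl ; (suc zero) (s≤s ()) }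

  powP-q+1-monic : ∀ e → Monic e (powP q+1 e) × coeff (powP q+1 e) 0 ≡ + 1
  powP-q+1-monic zero    = (refl , λ { (suc i) _ → refl }) , refl
  powP-q+1-monic (suc e) with powP-q+1-monic e
  ... | monic@(_ , above) , constant =
    (coeff-mulP-top q+1 (powP q+1 e) 1 e monic (proj₂ q+1-monic) , mulP-vanishesFrom q+1 (powP q+1 e) 2 e (proj₂ q+1-monic) above) ,
    trans (coeff-mulP-zero (+ 1) (+ 1 ∷ []) (powP q+1 e)) (cong (+ 1 *_) constant)

  powP-q-vanishesFrom : ∀ j → VanishesFrom (suc j) (powP qP j)
  powP-q-vanishesFrom j i j<i = trans (coeff-powP-q j i) (δ-> j<i)

  coeff-expansionTerm-0 : ∀ j e → coeff (expansionTerm j e) 0 ≡ δ 0 j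
  coeff-expansionTerm-0 j e = begin
    coeff (expansionTerm j e) 0                 ≡⟨ coeff-mulP-at-0 (powP qP j) (powP q+1 e) ⟩
    coeff (powP qP j) 0 * coeff (powP q+1 e) 0  ≡⟨ cong₂ _*_ (coeff-powP-q j 0) (proj₂ (powP-q+1-monic e)) ⟩
    δ 0 j * + 1                                 ≡⟨ ℤ.*-identityʳ _ ⟩
    δ 0 j                                       ∎

  coeff-expansionTerm-top : ∀ j e → coeff (expansionTerm j e) (j ℕ.+ e) ≡ + 1
  coeff-expansionTerm-top j e = begin
    coeff (expansionTerm j e) (j ℕ.+ e)  ≡⟨ coeff-mulP-top (powP qP j) (powP q+1 e) j e (proj₁ (powP-q+1-monic e)) (powP-q-vanishesFrom j) ⟩
    coeff (powP qP j) j                  ≡⟨ coeff-powP-q j j ⟩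
    δ j j                                ≡⟨ δ-refl j ⟩
    + 1                                  ∎

  expansionTerm-vanishesFrom : ∀ j e → VanishesFrom (suc (j ℕ.+ e)) (expansionTerm j e)
  expansionTerm-vanishesFrom j e = mulP-vanishesFrom (powP qP j) (powP q+1 e) (suc j) e (powP-q-vanishesFrom j) (proj₂ (proj₁ (powP-q+1-monic e)))

  coeff-expandF : ∀ m j g γ i → coeff (expandF m j (g ∷ γ)) i ≡ g * coeff (expansionTerm j (m ∸ 2 ℕ.* j)) i + coeff (expandF m (suc j) γ) i
  coeff-expandF m j g γ i = trans (coeff-addP (scaleP g (expansionTerm j (m ∸ 2 ℕ.* j))) (expandF m (suc j) γ) i)
    (cong (_+ coeff (expandF m (suc j) γ) i) (coeff-scaleP g (expansionTerm j (m ∸ 2 ℕ.* j)) i))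

  expandF-vanishesFrom : ∀ m j γ → WellIndexed m j γ → ∀ i → m < i ℕ.+ j → coeff (expandF m j γ) i ≡ + 0
  expandF-vanishesFrom m j []      wi i m<i+j = refl
  expandF-vanishesFrom m j (g ∷ γ) wi i m<i+j = begin
    coeff (expandF m j (g ∷ γ)) i                                                ≡⟨ coeff-expandF m j g γ i ⟩
    g * coeff (expansionTerm j (m ∸ 2 ℕ.* j)) i + coeff (expandF m (suc j) γ) i
      ≡⟨ cong₂ _+_ (cong (g *_) (expansionTerm-vanishesFrom j (m ∸ 2 ℕ.* j) i degree<i))
         (expandF-vanishesFrom m (suc j) γ (WellIndexed-tail m j g γ wi) i (ℕ.<-≤-trans m<i+j (ℕ.+-monoʳ-≤ i (ℕ.n≤1+n j)))) ⟩
    g * + 0 + + 0                                                                ≡⟨ cong (_+ + 0) (ℤ.*-zeroʳ g) ⟩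
    + 0                                                                          ∎
    where
    degree<i : j ℕ.+ (m ∸ 2 ℕ.* j) < i
    degree<i = ℕ.+-cancelʳ-< j (j ℕ.+ (m ∸ 2 ℕ.* j)) i (subst (_< i ℕ.+ j) (WellIndexed-head m j g γ wi) m<i+j)

  coeff-expandF-suc-0 : ∀ m j γ → coeff (expandF m (suc j) γ) 0 ≡ + 0
  coeff-expandF-suc-0 m j []      = refl
  coeff-expandF-suc-0 m j (g ∷ γ) = begin
    coeff (expandF m (suc j) (g ∷ γ)) 0  ≡⟨ coeff-expandF m (suc j) g γ 0 ⟩
    g * coeff (expansionTerm (suc j) (m ∸ 2 ℕ.* suc j)) 0 + coeff (expandF m (2 ℕ.+ j) γ) 0
      ≡⟨ cong₂ _+_ (cong (g *_) (coeff-expansionTerm-0 (suc j) (m ∸ 2 ℕ.* suc j))) (coeff-expandF-suc-0 m (suc j) γ) ⟩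
    g * + 0 + + 0                        ≡⟨ cong (_+ + 0) (ℤ.*-zeroʳ g) ⟩
    + 0                                  ∎

  coeff-alternating : ∀ k i → coeff (alternating k) i ≡ alt-sign i * δ< i k
  coeff-alternating zero    i       = trans (sym (ℤ.*-zeroʳ (alt-sign i))) (cong (alt-sign i *_) (sym (δ<-zero i)))
  coeff-alternating (suc k) zero    = refl
  coeff-alternating (suc k) (suc i) = begin
    coeff (negP (alternating k)) i  ≡⟨ coeff-negP (alternating k) i ⟩
    - coeff (alternating k) i       ≡⟨ cong -_ (coeff-alternating k i) ⟩
    - (alt-sign i * δ< i k)         ≡⟨ ℤ.neg-distribˡ-* (alt-sign i) (δ< i k) ⟩
    - alt-sign i * δ< i k           ∎

  coeff-alternating-below : ∀ {k i} → i < k → coeff (alternating k) i ≢ + 0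
  coeff-alternating-below {suc k} {zero}  _         ()
  coeff-alternating-below {suc k} {suc i} (s≤s i<k) c≡0 = coeff-alternating-below i<k (begin
    coeff (alternating k) i           ≡⟨ ℤ.neg-involutive _ ⟨
    - - coeff (alternating k) i       ≡⟨ cong -_ (coeff-negP (alternating k) i) ⟨
    - coeff (negP (alternating k)) i  ≡⟨ cong -_ c≡0 ⟩
    + 0                               ∎)

  alternating-vanishesFrom : ∀ k → VanishesFrom k (alternating k)
  alternating-vanishesFrom k i k≤i = trans (coeff-alternating k i) (trans (cong (alt-sign i *_) (δ<-≥ k≤i)) (ℤ.*-zeroʳ (alt-sign i)))
    where
    δ<-≥ : ∀ {i k} → k ≤ i → δ< i k ≡ + 0
    δ<-≥ {i}     {zero}  _         = δ<-zero i
    δ<-≥ {suc i} {suc k} (s≤s k≤i) = δ<-≥ k≤i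

  expansion-degree : ∀ m γ n → WellIndexed m 0 γ → expandF m 0 γ ≈ᶜ alternating (suc n) → m ≡ n
  expansion-degree m []      n wi eq = ⊥-elim (coeff-alternating-below {suc n} (s≤s z≤n) (sym (eq 0)))
  expansion-degree m (g ∷ γ) n wi eq = ℕ.≤-antisym (ℕ.s≤s⁻¹ m<1+n) n≤m
    where
    constant-coeff : coeff (expandF m 0 (g ∷ γ)) 0 ≡ g
    constant-coeff = begin
      coeff (expandF m 0 (g ∷ γ)) 0                              ≡⟨ coeff-expandF m 0 g γ 0 ⟩
      g * coeff (expansionTerm 0 m) 0 + coeff (expandF m 1 γ) 0  ≡⟨ cong₂ _+_ (cong (g *_) (coeff-expansionTerm-0 0 m)) (coeff-expandF-suc-0 m 0 γ) ⟩
      g * + 1 + + 0                                              ≡⟨ trans (ℤ.+-identityʳ _) (ℤ.*-identityʳ g) ⟩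
      g                                                          ∎
    top-coeff : coeff (expandF m 0 (g ∷ γ)) m ≡ g
    top-coeff = begin
      coeff (expandF m 0 (g ∷ γ)) m                              ≡⟨ coeff-expandF m 0 g γ m ⟩
      g * coeff (expansionTerm 0 m) m + coeff (expandF m 1 γ) m  ≡⟨ cong₂ _+_ (cong (g *_) (coeff-expansionTerm-top 0 m))
                                                                    (expandF-vanishesFrom m 1 γ (WellIndexed-tail m 0 g γ wi) m (subst (m <_) (ℕ.+-comm 1 m) (ℕ.n<1+n m))) ⟩
      g * + 1 + + 0                                              ≡⟨ trans (ℤ.+-identityʳ _) (ℤ.*-identityʳ g) ⟩
      g                                                          ∎
    1≢0 : + 1 ≢ + 0
    1≢0 ()
    g≡1 : g ≡ + 1
    g≡1 = trans (sym constant-coeff) (eq 0)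
    m<1+n : m < suc n
    m<1+n with m ℕ.<? suc n
    ... | yes m<1+n = m<1+n
    ... | no  m≮1+n = ⊥-elim (1≢0 (trans (sym g≡1) (trans (sym top-coeff) (trans (eq m) (alternating-vanishesFrom (suc n) m (ℕ.≮⇒≥ m≮1+n))))))
    n≤m : n ≤ m
    n≤m with n ℕ.≤? m
    ... | yes n≤m = n≤m
    ... | no  n≰m = ⊥-elim (coeff-alternating-below (ℕ.n<1+n n)
                     (trans (sym (eq n)) (expandF-vanishesFrom m 0 (g ∷ γ) wi n (subst (m <_) (sym (ℕ.+-identityʳ n)) (ℕ.≰⇒> n≰m)))))

  length-addP : ∀ f g n → length f ≤ n → length g ≤ n → length (addP f g) ≤ n
  length-addP []      g       n       f≤n       g≤n       = g≤n
  length-addP (a ∷ f) []      n       f≤n       g≤n       = f≤n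
  length-addP (a ∷ f) (b ∷ g) (suc n) (s≤s f≤n) (s≤s g≤n) = s≤s (length-addP f g n f≤n g≤n)

  length-scaleP : ∀ c f → length (scaleP c f) P.≡ length f
  length-scaleP c = List.length-map (c ℤ.*_)

  length-mulP : ∀ f g i j → length f ≤ suc i → length g ≤ suc j → length (mulP f g) ≤ suc (i ℕ.+ j)
  length-mulP []          g i       j f≤        g≤ = z≤n
  length-mulP (a ∷ [])    g i       j f≤        g≤ =
    length-addP (scaleP a g) (+ 0 ∷ []) _ (P.subst (_≤ suc (i ℕ.+ j)) (P.sym (length-scaleP a g)) (ℕ.≤-trans g≤ (s≤s (ℕ.m≤n+m j i)))) (s≤s z≤n)
  length-mulP (a ∷ b ∷ f) g (suc i) j (s≤s f≤) g≤ =
    length-addP (scaleP a g) (+ 0 ∷ mulP (b ∷ f) g) _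
      (P.subst (_≤ suc (suc i ℕ.+ j)) (P.sym (length-scaleP a g)) (ℕ.≤-trans g≤ (s≤s (ℕ.m≤n+m j (suc i)))))
      (s≤s (length-mulP (b ∷ f) g i j f≤ g≤))

  length-powP : ∀ f → length f ≤ 2 → ∀ n → length (powP f n) ≤ suc n
  length-powP f f≤2 zero    = s≤s z≤n
  length-powP f f≤2 (suc n) = length-mulP f (powP f n) 1 n f≤2 (length-powP f f≤2 n)

  length-expansionTerm : ∀ j e → length (expansionTerm j e) ≤ suc (j ℕ.+ e)
  length-expansionTerm j e = length-mulP (powP qP j) (powP q+1 e) j e (length-powP qP (s≤s (s≤s z≤n)) j) (length-powP q+1 (s≤s (s≤s z≤n)) e)

open AtomExpansion

toList-WellIndexed : ∀ m (γ : Vec ℤ (suc ⌊ m /2⌋)) → WellIndexed m 0 (toList γ)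
toList-WellIndexed m γ l l<γ = begin
  2 ℕ.* l              ≡⟨ P.cong (l ℕ.+_) (ℕ.+-identityʳ l) ⟩
  l ℕ.+ l              ≤⟨ ℕ.+-mono-≤ l≤m/2 (ℕ.≤-trans l≤m/2 (ℕ.⌊n/2⌋≤⌈n/2⌉ m)) ⟩
  ⌊ m /2⌋ ℕ.+ ⌈ m /2⌉  ≡⟨ ℕ.⌊n/2⌋+⌈n/2⌉≡n m ⟩
  m                    ∎
  where
  open ℕ.≤-Reasoning
  l≤m/2 : l ≤ ⌊ m /2⌋
  l≤m/2 = ℕ.s≤s⁻¹ (P.subst (l <_) (Vec.length-toList γ) l<γ)

module Power {c ℓ : Level} (S : CommutativeRing c ℓ) where
  open CommutativeRing S
  open import Relation.Binary.Reasoning.Setoid setoid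
  open import Algebra.Properties.CommutativeSemiring.Exp commutativeSemiring using (_^_; ^-congˡ; ^-homo-*; ^-distrib-*)
  open import Algebra.Properties.Ring ring using (-‿distribˡ-*)
  open IntegerCast S using (module Solver)

  pow≈^ : ∀ x n → pow S x n ≈ x ^ n
  pow≈^ x zero    = refl
  pow≈^ x (suc n) = *-congˡ (pow≈^ x n)

  pow-congˡ : ∀ n {x y} → x ≈ y → pow S x n ≈ pow S y n
  pow-congˡ n {x} {y} x≈y = trans (pow≈^ x n) (trans (^-congˡ n x≈y) (sym (pow≈^ y n)))

  pow-+ : ∀ x m n → pow S x (m ℕ.+ n) ≈ pow S x m * pow S x n
  pow-+ x m n = trans (pow≈^ x (m ℕ.+ n)) (trans (^-homo-* x m n) (sym (*-cong (pow≈^ x m) (pow≈^ x n))))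

  pow-distrib-* : ∀ x y n → pow S (x * y) n ≈ pow S x n * pow S y n
  pow-distrib-* x y n = trans (pow≈^ (x * y) n) (trans (^-distrib-* x y n) (sym (*-cong (pow≈^ x n) (pow≈^ y n))))

  pow-neg-even : ∀ x k → pow S (- x) (k ℕ.+ k) ≈ pow S x (k ℕ.+ k)
  pow-neg-even x zero    = refl
  pow-neg-even x (suc k) = begin
    pow S (- x) (suc k ℕ.+ suc k)        ≡⟨ P.cong (pow S (- x)) (P.cong suc (ℕ.+-suc k k)) ⟩
    - x * (- x * pow S (- x) (k ℕ.+ k))  ≈⟨ *-congˡ (*-congˡ (pow-neg-even x k)) ⟩
    - x * (- x * pow S x (k ℕ.+ k))      ≈⟨ neg-neg-* x (pow S x (k ℕ.+ k)) ⟩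
    x * (x * pow S x (k ℕ.+ k))          ≡⟨ P.cong (pow S x) (P.cong suc (P.sym (ℕ.+-suc k k))) ⟩
    pow S x (suc k ℕ.+ suc k)            ∎
    where
    open Solver
    neg-neg-* : ∀ x y → - x * (- x * y) ≈ x * (x * y)
    neg-neg-* = solve 2 (λ x y → (:- x) :* ((:- x) :* y) := x :* (x :* y)) refl

  pow-neg-odd : ∀ x k → pow S (- x) (suc (k ℕ.+ k)) ≈ - pow S x (suc (k ℕ.+ k))
  pow-neg-odd x k = trans (*-congˡ (pow-neg-even x k)) (sym (-‿distribˡ-* x _))

module HomogeneousEvaluation {c ℓ : Level} (S : CommutativeRing c ℓ) (x y : CommutativeRing.Carrier S) where
  open CommutativeRing S
  open import Relation.Binary.Reasoning.Setoid setoid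
  open IntegerCast S using (module Solver; ℤ→R-+; ℤ→R-*)
  open Solver
  open Power S

  -- evalʰ m f = Σᵢ fᵢ xⁱ yᵐ⁻ⁱ, the value at q = x/y of f homogenised to degree m;
  -- it is only meaningful when length f ≤ suc m, because of the truncated m ∸ 1.
  evalʰ : ℕ → Poly → Carrier
  evalʰ m []      = 0#
  evalʰ m (a ∷ f) = ℤ→R S a * pow S y m + x * evalʰ (m ∸ 1) f

  evalʰ-addP : ∀ m f g → evalʰ m (addP f g) ≈ evalʰ m f + evalʰ m g
  evalʰ-addP m []      g       = sym (+-identityˡ _)
  evalʰ-addP m (a ∷ f) []      = sym (+-identityʳ _)
  evalʰ-addP m (a ∷ f) (b ∷ g) = begin
    ℤ→R S (a ℤ.+ b) * pow S y m + x * evalʰ (m ∸ 1) (addP f g)  ≈⟨ +-cong (*-congʳ (ℤ→R-+ a b)) (*-congˡ (evalʰ-addP (m ∸ 1) f g)) ⟩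
    (A + B) * Y + x * (F + G)
      ≈⟨ solve 6 (λ A B Y x F G → (A :+ B) :* Y :+ x :* (F :+ G) := (A :* Y :+ x :* F) :+ (B :* Y :+ x :* G)) refl A B Y x F G ⟩
    evalʰ m (a ∷ f) + evalʰ m (b ∷ g)                           ∎
    where A = ℤ→R S a ; B = ℤ→R S b ; Y = pow S y m ; F = evalʰ (m ∸ 1) f ; G = evalʰ (m ∸ 1) g

  evalʰ-scaleP : ∀ m c f → evalʰ m (scaleP c f) ≈ ℤ→R S c * evalʰ m f
  evalʰ-scaleP m c []      = sym (zeroʳ _)
  evalʰ-scaleP m c (a ∷ f) = begin
    ℤ→R S (c ℤ.* a) * pow S y m + x * evalʰ (m ∸ 1) (scaleP c f)  ≈⟨ +-cong (*-congʳ (ℤ→R-* c a)) (*-congˡ (evalʰ-scaleP (m ∸ 1) c f)) ⟩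
    C * A * Y + x * (C * F)
      ≈⟨ solve 5 (λ C A Y x F → C :* A :* Y :+ x :* (C :* F) := C :* (A :* Y :+ x :* F)) refl C A Y x F ⟩
    ℤ→R S c * evalʰ m (a ∷ f)                                     ∎
    where C = ℤ→R S c ; A = ℤ→R S a ; Y = pow S y m ; F = evalʰ (m ∸ 1) f

  evalʰ-zero : ∀ m f → IsZero f → evalʰ m f ≈ 0#
  evalʰ-zero m []      f≈0 = refl
  evalʰ-zero m (a ∷ f) f≈0 = begin
    ℤ→R S a * pow S y m + x * evalʰ (m ∸ 1) f
      ≈⟨ +-cong (*-congʳ (reflexive (P.cong (ℤ→R S) (f≈0 0 z≤n)))) (*-congˡ (evalʰ-zero (m ∸ 1) f (λ i _ → f≈0 (suc i) z≤n))) ⟩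
    0# * pow S y m + x * 0#                    ≈⟨ solve 2 (λ Y x → con (+ 0) :* Y :+ x :* con (+ 0) := con (+ 0)) refl (pow S y m) x ⟩
    0#                                         ∎

  evalʰ-cong : ∀ m f g → f ≈ᶜ g → evalʰ m f ≈ evalʰ m g
  evalʰ-cong m []      []      f≈g = refl
  evalʰ-cong m []      (b ∷ g) f≈g = sym (evalʰ-zero m (b ∷ g) (λ i _ → P.sym (f≈g i)))
  evalʰ-cong m (a ∷ f) []      f≈g = evalʰ-zero m (a ∷ f) (λ i _ → f≈g i)
  evalʰ-cong m (a ∷ f) (b ∷ g) f≈g =
    +-cong (*-congʳ (reflexive (P.cong (ℤ→R S) (f≈g 0)))) (*-congˡ (evalʰ-cong (m ∸ 1) f g (λ i → f≈g (suc i))))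

  evalʰ-raise : ∀ g j k → length g ≤ suc j → evalʰ (k ℕ.+ j) g ≈ pow S y k * evalʰ j g
  evalʰ-raise g j k g≤ = trans (reflexive (P.cong (λ n → evalʰ n g) (ℕ.+-comm k j))) (raise g j k g≤)
    where
    raise : ∀ g j k → length g ≤ suc j → evalʰ (j ℕ.+ k) g ≈ pow S y k * evalʰ j g
    raise []          j       k g≤        = sym (zeroʳ _)
    raise (b ∷ [])    j       k g≤        = begin
      ℤ→R S b * pow S y (j ℕ.+ k) + x * 0#        ≈⟨ +-congʳ (*-congˡ (pow-+ y j k)) ⟩
      ℤ→R S b * (pow S y j * pow S y k) + x * 0#
        ≈⟨ solve 4 (λ B Yj Yk x → B :* (Yj :* Yk) :+ x :* con (+ 0) := Yk :* (B :* Yj :+ x :* con (+ 0))) refl (ℤ→R S b) (pow S y j) (pow S y k) x ⟩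
      pow S y k * evalʰ j (b ∷ [])                ∎
    raise (b ∷ c ∷ g) (suc j) k (s≤s g≤)  = begin
      ℤ→R S b * pow S y (suc j ℕ.+ k) + x * evalʰ (j ℕ.+ k) (c ∷ g)  ≈⟨ +-cong (*-congˡ (pow-+ y (suc j) k)) (*-congˡ (raise (c ∷ g) j k g≤)) ⟩
      ℤ→R S b * (pow S y (suc j) * pow S y k) + x * (pow S y k * evalʰ j (c ∷ g))
        ≈⟨ solve 5 (λ B Yj Yk x F → B :* (Yj :* Yk) :+ x :* (Yk :* F) := Yk :* (B :* Yj :+ x :* F)) refl (ℤ→R S b) (pow S y (suc j)) (pow S y k) x (evalʰ j (c ∷ g)) ⟩
      pow S y k * evalʰ (suc j) (b ∷ c ∷ g)                          ∎

  evalʰ-mulP : ∀ f g i j → length f ≤ suc i → length g ≤ suc j → evalʰ (i ℕ.+ j) (mulP f g) ≈ evalʰ i f * evalʰ j g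
  evalʰ-mulP []          g i       j f≤       g≤ = sym (zeroˡ _)
  evalʰ-mulP (a ∷ [])    g i       j f≤       g≤ = begin
    evalʰ (i ℕ.+ j) (addP (scaleP a g) (+ 0 ∷ []))                         ≈⟨ evalʰ-addP (i ℕ.+ j) (scaleP a g) (+ 0 ∷ []) ⟩
    evalʰ (i ℕ.+ j) (scaleP a g) + (0# * pow S y (i ℕ.+ j) + x * 0#)
      ≈⟨ +-congʳ (trans (evalʰ-scaleP (i ℕ.+ j) a g) (*-congˡ (evalʰ-raise g j i g≤))) ⟩
    ℤ→R S a * (pow S y i * evalʰ j g) + (0# * pow S y (i ℕ.+ j) + x * 0#)
      ≈⟨ solve 5 (λ A Yi G Yij x → A :* (Yi :* G) :+ (con (+ 0) :* Yij :+ x :* con (+ 0)) := (A :* Yi :+ x :* con (+ 0)) :* G) refl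
         (ℤ→R S a) (pow S y i) (evalʰ j g) (pow S y (i ℕ.+ j)) x ⟩
    evalʰ i (a ∷ []) * evalʰ j g                                           ∎
  evalʰ-mulP (a ∷ b ∷ f) g (suc i) j (s≤s f≤) g≤ = begin
    evalʰ (suc i ℕ.+ j) (addP (scaleP a g) (+ 0 ∷ mulP (b ∷ f) g))  ≈⟨ evalʰ-addP (suc i ℕ.+ j) (scaleP a g) _ ⟩
    evalʰ (suc i ℕ.+ j) (scaleP a g) + (0# * pow S y (suc i ℕ.+ j) + x * evalʰ (i ℕ.+ j) (mulP (b ∷ f) g))
      ≈⟨ +-cong (trans (evalʰ-scaleP (suc i ℕ.+ j) a g) (*-congˡ (evalʰ-raise g j (suc i) g≤))) (+-congˡ (*-congˡ (evalʰ-mulP (b ∷ f) g i j f≤ g≤))) ⟩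
    ℤ→R S a * (pow S y (suc i) * evalʰ j g) + (0# * pow S y (suc i ℕ.+ j) + x * (evalʰ i (b ∷ f) * evalʰ j g))
      ≈⟨ solve 6 (λ A Yi G Yij x F → A :* (Yi :* G) :+ (con (+ 0) :* Yij :+ x :* (F :* G)) := (A :* Yi :+ x :* F) :* G) refl
         (ℤ→R S a) (pow S y (suc i)) (evalʰ j g) (pow S y (suc i ℕ.+ j)) x (evalʰ i (b ∷ f)) ⟩
    evalʰ (suc i) (a ∷ b ∷ f) * evalʰ j g                           ∎

  evalʰ-powP : ∀ f → length f ≤ 2 → ∀ n → evalʰ n (powP f n) ≈ pow S (evalʰ 1 f) n
  evalʰ-powP f f≤2 zero    = solve 1 (λ x → (con (+ 1) :+ con (+ 0)) :* con (+ 1) :+ x :* con (+ 0) := con (+ 1)) refl x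
  evalʰ-powP f f≤2 (suc n) = begin
    evalʰ (1 ℕ.+ n) (mulP f (powP f n))  ≈⟨ evalʰ-mulP f (powP f n) 1 n f≤2 (length-powP f f≤2 n) ⟩
    evalʰ 1 f * evalʰ n (powP f n)       ≈⟨ *-congˡ (evalʰ-powP f f≤2 n) ⟩
    evalʰ 1 f * pow S (evalʰ 1 f) n      ∎

  evalʰ-q : evalʰ 1 qP ≈ x
  evalʰ-q = solve 2 (λ x y → con (+ 0) :* (y :* con (+ 1)) :+ x :* ((con (+ 1) :+ con (+ 0)) :* con (+ 1) :+ x :* con (+ 0)) := x) refl x y

  evalʰ-q+1 : evalʰ 1 q+1 ≈ x + y
  evalʰ-q+1 = solve 2 (λ x y → (con (+ 1) :+ con (+ 0)) :* (y :* con (+ 1)) :+ x :* ((con (+ 1) :+ con (+ 0)) :* con (+ 1) :+ x :* con (+ 0)) := x :+ y) refl x y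

  evalʰ-expansionTerm : ∀ j e → evalʰ (j ℕ.+ e ℕ.+ j) (expansionTerm j e) ≈ pow S (y * x) j * pow S (x + y) e
  evalʰ-expansionTerm j e = begin
    evalʰ (j ℕ.+ e ℕ.+ j) (expansionTerm j e)                 ≈⟨ reflexive (P.cong (λ n → evalʰ n (expansionTerm j e)) (ℕ.+-comm (j ℕ.+ e) j)) ⟩
    evalʰ (j ℕ.+ (j ℕ.+ e)) (expansionTerm j e)               ≈⟨ evalʰ-raise (expansionTerm j e) (j ℕ.+ e) j (length-expansionTerm j e) ⟩
    pow S y j * evalʰ (j ℕ.+ e) (expansionTerm j e)
      ≈⟨ *-congˡ (evalʰ-mulP (powP qP j) (powP q+1 e) j e (length-powP qP (s≤s (s≤s z≤n)) j) (length-powP q+1 (s≤s (s≤s z≤n)) e)) ⟩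
    pow S y j * (evalʰ j (powP qP j) * evalʰ e (powP q+1 e))
      ≈⟨ *-congˡ (*-cong (trans (evalʰ-powP qP (s≤s (s≤s z≤n)) j) (pow-congˡ j evalʰ-q)) (trans (evalʰ-powP q+1 (s≤s (s≤s z≤n)) e) (pow-congˡ e evalʰ-q+1))) ⟩
    pow S y j * (pow S x j * pow S (x + y) e)                 ≈⟨ sym (*-assoc _ _ _) ⟩
    pow S y j * pow S x j * pow S (x + y) e                   ≈⟨ *-congʳ (sym (pow-distrib-* y x j)) ⟩
    pow S (y * x) j * pow S (x + y) e                         ∎

  evalʰ-expandF : ∀ m j γ → WellIndexed m j γ → evalʰ m (expandF m j γ) ≈ atomF S (x + y) (- (y * x)) m j γ
  evalʰ-expandF m j []      wi = refl
  evalʰ-expandF m j (g ∷ γ) wi = begin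
    evalʰ m (addP (scaleP g (expansionTerm j e)) (expandF m (suc j) γ))     ≈⟨ evalʰ-addP m (scaleP g (expansionTerm j e)) _ ⟩
    evalʰ m (scaleP g (expansionTerm j e)) + evalʰ m (expandF m (suc j) γ)
      ≈⟨ +-cong (evalʰ-scaleP m g (expansionTerm j e)) (evalʰ-expandF m (suc j) γ (WellIndexed-tail m j g γ wi)) ⟩
    G * evalʰ m (expansionTerm j e) + rest
      ≡⟨ P.cong (λ n → G * evalʰ n (expansionTerm j e) + rest) (WellIndexed-head m j g γ wi) ⟩
    G * evalʰ (j ℕ.+ e ℕ.+ j) (expansionTerm j e) + rest                    ≈⟨ +-congʳ (*-congˡ (evalʰ-expansionTerm j e)) ⟩
    G * (pow S (y * x) j * pow S (x + y) e) + rest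
      ≈⟨ +-congʳ (*-congˡ (*-congʳ (pow-congˡ j (sym (-‿involutive (y * x)))))) ⟩
    G * (pow S (- - (y * x)) j * pow S (x + y) e) + rest                    ≈⟨ +-congʳ (solve 3 (λ G A B → G :* (A :* B) := G :* B :* A) refl G _ _) ⟩
    atomF S (x + y) (- (y * x)) m j (g ∷ γ)                                 ∎
    where
    open import Algebra.Properties.Ring ring using (-‿involutive)
    e = m ∸ 2 ℕ.* j
    G = ℤ→R S g
    rest = atomF S (x + y) (- (y * x)) m (suc j) γ

  evalʰ-alternating : ∀ n → (x + y) * evalʰ n (alternating (suc n)) ≈ pow S y (suc n) - pow S (- x) (suc n)
  evalʰ-alternating zero = solve 2 (λ x y → (x :+ y) :* ((con (+ 1) :+ con (+ 0)) :* con (+ 1) :+ x :* con (+ 0)) := y :* con (+ 1) :- (:- x) :* con (+ 1)) refl x y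
  evalʰ-alternating (suc n) = begin
    (x + y) * (ℤ→R S (+ 1) * Y + x * evalʰ n (negP (alternating (suc n))))
      ≈⟨ *-congˡ (+-congˡ (*-congˡ (evalʰ-scaleP n (ℤ.- + 1) (alternating (suc n))))) ⟩
    (x + y) * (ℤ→R S (+ 1) * Y + x * (ℤ→R S (ℤ.- + 1) * A))
      ≈⟨ solve 4 (λ x y Y A → (x :+ y) :* ((con (+ 1) :+ con (+ 0)) :* Y :+ x :* (:- (con (+ 1) :+ con (+ 0)) :* A))
         := y :* Y :- x :* ((x :+ y) :* A) :+ x :* Y) refl x y Y A ⟩
    y * Y - x * ((x + y) * A) + x * Y                                       ≈⟨ +-congʳ (+-congˡ (-‿cong (*-congˡ (evalʰ-alternating n)))) ⟩
    y * Y - x * (Y - pow S (- x) (suc n)) + x * Y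
      ≈⟨ solve 4 (λ x y Y X → y :* Y :- x :* (Y :- X) :+ x :* Y := y :* Y :- (:- x) :* X) refl x y Y (pow S (- x) (suc n)) ⟩
    pow S y (2 ℕ.+ n) - pow S (- x) (2 ℕ.+ n)                               ∎
    where
    Y = pow S y (suc n)
    A = evalʰ n (alternating (suc n))

module QuadraticExtension {c ℓ : Level} (R : CommutativeRing c ℓ) (s t : CommutativeRing.Carrier R) where
  open CommutativeRing R
  open IntegerCast R using (module Solver)
  open Solver

  -- (a , b) represents a + b α in R[α] / (α² − s α − t).
  infixl 7 _*²_
  _*²_ : Carrier × Carrier → Carrier × Carrier → Carrier × Carrier
  (a , b) *² (c , d) = (a * c + t * (b * d) , a * d + b * c + s * (b * d))

  private
    +-abelianGroup² : AbelianGroup c ℓ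
    +-abelianGroup² = DirectProduct.abelianGroup +-abelianGroup +-abelianGroup
    open AbelianGroup +-abelianGroup² using () renaming (_≈_ to _≈²_; _∙_ to _+²_; setoid to setoid²)
    open import Algebra.Consequences.Setoid setoid² using (comm∧idˡ⇒id; comm∧distrˡ⇒distr)

    1² : Carrier × Carrier
    1² = (1# , 0#)

    *²-comm : ∀ u v → u *² v ≈² v *² u
    *²-comm (a , b) (c , d) =
        solve 5 (λ t a b c d → a :* c :+ t :* (b :* d) := c :* a :+ t :* (d :* b)) refl t a b c d
      , solve 5 (λ s a b c d → a :* d :+ b :* c :+ s :* (b :* d) := c :* b :+ d :* a :+ s :* (d :* b)) refl s a b c d

    *²-cong : ∀ {u u′ v v′} → u ≈² u′ → v ≈² v′ → u *² v ≈² u′ *² v′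
    *²-cong (a≈ , b≈) (c≈ , d≈) = +-cong (*-cong a≈ c≈) (*-congˡ (*-cong b≈ d≈))
                                , +-cong (+-cong (*-cong a≈ d≈) (*-cong b≈ c≈)) (*-congˡ (*-cong b≈ d≈))

    *²-assoc : ∀ u v w → (u *² v) *² w ≈² u *² (v *² w)
    *²-assoc (a , b) (c , d) (e , f) =
        solve 8 (λ s t a b c d e f → (a :* c :+ t :* (b :* d)) :* e :+ t :* ((a :* d :+ b :* c :+ s :* (b :* d)) :* f)
                                   := a :* (c :* e :+ t :* (d :* f)) :+ t :* (b :* (c :* f :+ d :* e :+ s :* (d :* f)))) refl s t a b c d e f
      , solve 8 (λ s t a b c d e f → (a :* c :+ t :* (b :* d)) :* f :+ (a :* d :+ b :* c :+ s :* (b :* d)) :* e :+ s :* ((a :* d :+ b :* c :+ s :* (b :* d)) :* f)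
                                   := a :* (c :* f :+ d :* e :+ s :* (d :* f)) :+ b :* (c :* e :+ t :* (d :* f)) :+ s :* (b :* (c :* f :+ d :* e :+ s :* (d :* f)))) refl s t a b c d e f

    *²-identityˡ : ∀ u → 1² *² u ≈² u
    *²-identityˡ (a , b) = solve 3 (λ t a b → con (+ 1) :* a :+ t :* (con (+ 0) :* b) := a) refl t a b
                         , solve 3 (λ s a b → con (+ 1) :* b :+ con (+ 0) :* a :+ s :* (con (+ 0) :* b) := b) refl s a b

    *²-distribˡ : ∀ u v w → u *² (v +² w) ≈² (u *² v) +² (u *² w)
    *²-distribˡ (a , b) (c , d) (e , f) =
        solve 7 (λ t a b c d e f → a :* (c :+ e) :+ t :* (b :* (d :+ f)) := (a :* c :+ t :* (b :* d)) :+ (a :* e :+ t :* (b :* f))) refl t a b c d e f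
      , solve 7 (λ s a b c d e f → a :* (d :+ f) :+ b :* (c :+ e) :+ s :* (b :* (d :+ f)) := (a :* d :+ b :* c :+ s :* (b :* d)) :+ (a :* f :+ b :* e :+ s :* (b :* f))) refl s a b c d e f

  ring² : CommutativeRing c ℓ
  ring² = record
    { isCommutativeRing = record
      { isRing = record
        { +-isAbelianGroup = AbelianGroup.isAbelianGroup +-abelianGroup²
        ; *-cong           = *²-cong
        ; *-assoc          = *²-assoc
        ; *-identity       = comm∧idˡ⇒id *²-comm *²-identityˡ
        ; distrib          = comm∧distrˡ⇒distr (AbelianGroup.∙-cong +-abelianGroup²) *²-comm *²-distribˡ
        }
      ; *-comm = *²-comm
      }
    }

  private
    module R² = CommutativeRing ring²

  ι : Carrier → R².Carrier
  ι a = (a , 0#)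

  α β : R².Carrier
  α = (0# , 1#)
  β = (s , - 1#)

  ι-+ : ∀ a b → ι a R².+ ι b R².≈ ι (a + b)
  ι-+ a b = refl , +-identityʳ 0#

  ι-* : ∀ a b → ι a R².* ι b R².≈ ι (a * b)
  ι-* a b = solve 3 (λ t a b → a :* b :+ t :* (con (+ 0) :* con (+ 0)) := a :* b) refl t a b
          , solve 3 (λ s a b → a :* con (+ 0) :+ con (+ 0) :* b :+ s :* (con (+ 0) :* con (+ 0)) := con (+ 0)) refl s a b

  ι-nat→R : ∀ k → nat→R ring² k R².≈ ι (nat→R R k)
  ι-nat→R zero    = R².refl
  ι-nat→R (suc k) = R².trans (R².+-congˡ (ι-nat→R k)) (ι-+ 1# (nat→R R k))

  ι-ℤ→R : ∀ g → ℤ→R ring² g R².≈ ι (ℤ→R R g)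
  ι-ℤ→R (+ n)    = ι-nat→R n
  ι-ℤ→R -[1+ n ] = R².trans (R².-‿cong (ι-nat→R (suc n))) (refl , -0#≈0#)
    where open import Algebra.Properties.Ring ring using (-0#≈0#)

  ι-pow : ∀ a n → pow ring² (ι a) n R².≈ ι (pow R a n)
  ι-pow a zero    = R².refl
  ι-pow a (suc n) = R².trans (R².*-congˡ (ι-pow a n)) (ι-* a (pow R a n))

  α+β : α R².+ β R².≈ ι s
  α+β = +-identityˡ s , -‿inverseʳ 1#

  -β*α : R².- (β R².* α) R².≈ ι t
  -β*α = solve 2 (λ s t → :- (s :* con (+ 0) :+ t :* ((:- con (+ 1)) :* con (+ 1))) := t) refl s t
       , solve 1 (λ s → :- (s :* con (+ 1) :+ (:- con (+ 1)) :* con (+ 0) :+ s :* ((:- con (+ 1)) :* con (+ 1))) := con (+ 0)) refl s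

  pow-α : ∀ n → pow ring² α (suc n) R².≈ (t * lucas R s t n , lucas R s t (suc n))
  pow-α zero    = solve 1 (λ t → con (+ 0) :* con (+ 1) :+ t :* (con (+ 1) :* con (+ 0)) := t :* con (+ 0)) refl t
                , solve 1 (λ s → con (+ 0) :* con (+ 0) :+ con (+ 1) :* con (+ 1) :+ s :* (con (+ 1) :* con (+ 0)) := con (+ 1)) refl s
  pow-α (suc n) = R².trans (R².*-congˡ (pow-α n))
    ( solve 3 (λ t u₀ u₁ → con (+ 0) :* (t :* u₀) :+ t :* (con (+ 1) :* u₁) := t :* u₁) refl t (u n) (u (suc n))
    , solve 4 (λ s t u₀ u₁ → con (+ 0) :* u₁ :+ con (+ 1) :* (t :* u₀) :+ s :* (con (+ 1) :* u₁) := s :* u₁ :+ t :* u₀) refl s t (u n) (u (suc n)))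
    where u = lucas R s t

  pow-β : ∀ n → pow ring² β (suc n) R².≈ (t * lucas R s t n + s * lucas R s t (suc n) , - lucas R s t (suc n))
  pow-β zero    = solve 2 (λ s t → s :* con (+ 1) :+ t :* ((:- con (+ 1)) :* con (+ 0)) := t :* con (+ 0) :+ s :* con (+ 1)) refl s t
                , solve 1 (λ s → s :* con (+ 0) :+ (:- con (+ 1)) :* con (+ 1) :+ s :* ((:- con (+ 1)) :* con (+ 0)) := :- con (+ 1)) refl s
  pow-β (suc n) = R².trans (R².*-congˡ (pow-β n))
    ( solve 4 (λ s t u₀ u₁ → s :* (t :* u₀ :+ s :* u₁) :+ t :* ((:- con (+ 1)) :* (:- u₁)) := t :* u₁ :+ s :* (s :* u₁ :+ t :* u₀)) refl s t (u n) (u (suc n))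
    , solve 4 (λ s t u₀ u₁ → s :* (:- u₁) :+ (:- con (+ 1)) :* (t :* u₀ :+ s :* u₁) :+ s :* ((:- con (+ 1)) :* (:- u₁)) := :- (s :* u₁ :+ t :* u₀)) refl s t (u n) (u (suc n)))
    where u = lucas R s t

  atomF-ι : ∀ {s′ t′} → s′ R².≈ ι s → t′ R².≈ ι t → ∀ m j γ → atomF ring² s′ t′ m j γ R².≈ ι (atomF R s t m j γ)
  atomF-ι s′≈ t′≈ m j []      = R².refl
  atomF-ι {s′} {t′} s′≈ t′≈ m j (g ∷ γ) = R².trans (R².+-cong term≈ (atomF-ι s′≈ t′≈ m (suc j) γ)) (ι-+ _ _)
    where
    open Power ring² using (pow-congˡ)
    e = m ℕ.∸ 2 ℕ.* j
    term≈ : ℤ→R ring² g R².* pow ring² s′ e R².* pow ring² (R².- t′) j R².≈ ι (ℤ→R R g * pow R s e * pow R (- t) j)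
    term≈ = R².trans (R².*-cong (R².*-cong (ι-ℤ→R g) (R².trans (pow-congˡ e s′≈) (ι-pow s e)))
                                (R².trans (pow-congˡ j (R².-‿cong t′≈)) (R².trans (pow-congˡ j (refl , -0#≈0#)) (ι-pow (- t) j))))
                     (R².trans (R².*-congʳ (ι-* _ _)) (ι-* _ _))
      where open import Algebra.Properties.Ring ring using (-0#≈0#)

  lucas-atom : ∀ k γ → WellIndexed (k ℕ.+ k) 0 γ → expandF (k ℕ.+ k) 0 γ ≈ᶜ alternating (suc (k ℕ.+ k)) →
               s * atomF R s t (k ℕ.+ k) 0 γ ≈ lucas R s t (2 ℕ.+ (k ℕ.+ k)) + t * lucas R s t (k ℕ.+ k)
  lucas-atom k γ wi expansion = trans (proj₁ in-ring²)
    (solve 4 (λ s t u₀ u₁ → t :* u₀ :+ s :* u₁ :+ t :* u₀ := s :* u₁ :+ t :* u₀ :+ t :* u₀) refl s t (u m) (u (suc m)))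
    where
    open HomogeneousEvaluation ring² α β
    open Power ring² using (pow-neg-odd)
    open import Relation.Binary.Reasoning.Setoid R².setoid
    open import Algebra.Properties.Ring R².ring using (-‿involutive)
    m = k ℕ.+ k
    u = lucas R s t
    in-ring² : ι (s * atomF R s t m 0 γ) R².≈ (t * u m + s * u (suc m) + t * u m , - u (suc m) + u (suc m))
    in-ring² = begin
      ι (s * atomF R s t m 0 γ)                                       ≈⟨ ι-* s _ ⟨
      ι s R².* ι (atomF R s t m 0 γ)                                  ≈⟨ R².*-cong α+β (atomF-ι α+β -β*α m 0 γ) ⟨
      (α R².+ β) R².* atomF ring² (α R².+ β) (R².- (β R².* α)) m 0 γ  ≈⟨ R².*-congˡ (evalʰ-expandF m 0 γ wi) ⟨
      (α R².+ β) R².* evalʰ m (expandF m 0 γ)                         ≈⟨ R².*-congˡ (evalʰ-cong m (expandF m 0 γ) (alternating (suc m)) expansion) ⟩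
      (α R².+ β) R².* evalʰ m (alternating (suc m))                   ≈⟨ evalʰ-alternating m ⟩
      pow ring² β (suc m) R².- pow ring² (R².- α) (suc m)             ≈⟨ R².+-congˡ (R².-‿cong (pow-neg-odd α k)) ⟩
      pow ring² β (suc m) R².- R².- pow ring² α (suc m)               ≈⟨ R².+-congˡ (-‿involutive _) ⟩
      pow ring² β (suc m) R².+ pow ring² α (suc m)                    ≈⟨ R².+-cong (pow-β m) (pow-α m) ⟩
      (t * u m + s * u (suc m) + t * u m , - u (suc m) + u (suc m))   ∎

module _ {c ℓ : Level} (R : CommutativeRing c ℓ) (s t : CommutativeRing.Carrier R) where
  open CommutativeRing R

  s*lucasAtom[2p]≈lucas[p+1]+t*lucas[p-1] :
    ∀ r → Prime (3 ℕ.+ r) → ∀ k → 3 ℕ.+ r ≡ suc (k ℕ.+ k) → (γ : Vec ℤ (suc ⌊ totient (2 ℕ.* (3 ℕ.+ r)) /2⌋)) →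
    IsAtomCoeffs (2 ℕ.* (3 ℕ.+ r)) γ →
    s * lucasAtom R (2 ℕ.* (3 ℕ.+ r)) γ s t ≈ lucas R s t (2 ℕ.+ (k ℕ.+ k)) + t * lucas R s t (k ℕ.+ k)
  s*lucasAtom[2p]≈lucas[p+1]+t*lucas[p-1] r p-prime k p≡2k+1 γ atom =
    P.subst (λ m → s * atomF R s t m 0 (toList γ) ≈ V) (P.sym φ≡k+k)
      (lucas-atom k (toList γ) (P.subst (λ m → WellIndexed m 0 (toList γ)) φ≡k+k well-indexed)
                               (P.subst (λ m → expandF m 0 (toList γ) ≈ᶜ alternating (suc (k ℕ.+ k))) φ≡k+k expansion))
    where
    open QuadraticExtension R s t using (lucas-atom)
    V = lucas R s t (2 ℕ.+ (k ℕ.+ k)) + t * lucas R s t (k ℕ.+ k)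
    φ = totient (2 ℕ.* (3 ℕ.+ r))
    well-indexed = toList-WellIndexed φ γ
    expansion : expandF φ 0 (toList γ) ≈ᶜ alternating (suc (k ℕ.+ k))
    expansion i = P.trans (P.sym (≈P⇒≈ᶜ (Φ (2 ℕ.* (3 ℕ.+ r))) (expandF φ 0 (toList γ)) atom i))
                          (P.trans (cycF-2p r p-prime i) (P.cong (λ p → coeff (alternating p) i) p≡2k+1))
    φ≡k+k : φ ≡ k ℕ.+ k
    φ≡k+k = expansion-degree φ (toList γ) (k ℕ.+ k) well-indexed expansion

lemma5p8 : {c ℓ : Level} (R : CommutativeRing c ℓ) (p : ℕ) → Prime p →
    let open CommutativeRing R in
    (s t : Carrier) (n : ℕ) →
      (p ≡ 2 →
        lucas R s t (p ℕ.* n) ≈ lucas R s t p * lucas R (s * s + (t + t)) (- (t * t)) n)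
      × (p ≥ 3 → (γ : Vec ℤ _) → IsAtomCoeffs (2 ℕ.* p) γ →
        lucas R s t (p ℕ.* n) ≈ lucas R s t p * lucas R (s * lucasAtom R (2 ℕ.* p) γ s t) (pow R t p) n)
lemma5p8 R p p-prime s t n = p≡2 , p≥3
  where
  open CommutativeRing R
  open LucasSequence R s t using (lucas-multiple)
  open IntegerCast R using (module Solver)
  open Solver
  open Power R using (pow-neg-even)

  p≡2 : p ≡ 2 → lucas R s t (p ℕ.* n) ≈ lucas R s t p * lucas R (s * s + (t + t)) (- (t * t)) n
  p≡2 P.refl = lucas-multiple 1
    (solve 2 (λ s t → s :* s :+ (t :+ t) := s :* (s :* con (+ 1) :+ t :* con (+ 0)) :+ t :* con (+ 1) :+ t :* con (+ 1)) refl s t)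
    (solve 1 (λ t → :- (t :* t) := t :* ((:- t) :* con (+ 1))) refl t) n

  p≥3 : p ≥ 3 → (γ : Vec ℤ _) → IsAtomCoeffs (2 ℕ.* p) γ →
        lucas R s t (p ℕ.* n) ≈ lucas R s t p * lucas R (s * lucasAtom R (2 ℕ.* p) γ s t) (pow R t p) n
  p≥3 (s≤s (s≤s (s≤s {n = r} _))) γ atom with odd-prime r p-prime
  ... | _ , k , p≡2k+1 = P.subst (λ q → lucas R s t (q ℕ.* n) ≈ lucas R s t q * lucas R V (pow R t q) n) (P.sym p≡2k+1)
        (lucas-multiple (k ℕ.+ k) (s*lucasAtom[2p]≈lucas[p+1]+t*lucas[p-1] R s t r p-prime k p≡2k+1 γ atom) (*-congˡ (sym (pow-neg-even t k))) n)
    where V = s * lucasAtom R (2 ℕ.* p) γ s t
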